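{- Let $d \ge 2$ and $n = d+12$. On vertex set $\{1,\dots,n\}$, for each integer $i$ let $H_i$ be the $d$-face with vertices $i, i+1, \dots, i+d$ (sums modulo $n$). Let $C_d$ be the pure $d$-dimensional simplicial complex on $n$ vertices whose $n+4$ facets are $H_1, H_2, \dots, H_n$ together with $F_1 = [1, 5, 7, 8, \dots, d+5]$, $F_2 = [1, 7, 8, \dots, d+5, d+7]$, $F_3 = [2, 8, 10, 11, \dots, d+8]$, $F_4 = [2, 10, 11, \dots, d+8, d+10]$. Then $C_d$ has a tight-Hamiltonian cycle, and the dual graph of $C_d$ is $2$-connected but not Hamiltonian (though it admits a Hamiltonian path).
   Context: A tight-Hamiltonian cycle in a pure $d$-complex on $n$ vertices is a labeling of its vertices by $1,\dots,n$ such that all the $d$-faces $H_1,\dots,H_n$ (where $H_i = \{i,i+1,\dots,i+d\}$ with sums modulo $n$) are facets. The dual graph of a pure $d$-complex is the graph whose vertices are the facets, two facets being adjacent if they share a $(d-1)$-face (i.e., $d$ common vertices). A graph is $2$-connected if it has at least three vertices, is connected, and remains connected after deletion of any single vertex. -}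

module Defs where

open import Data.Nat using (ℕ; zero; suc; _+_; _∸_; _≤_; NonZero; pred)
open import Data.Nat.DivMod using (_mod_)
open import Data.Fin using (Fin; toℕ)
open import Data.Fin.Subset using (Subset; ⁅_⁆; _∪_; _∩_; ∣_∣; ⊥)
open import Data.List using (List; []; _∷_; map; upTo; _++_; length; foldr; lookup)
open import Data.List.Membership.Propositional using (_∈_)
open import Data.Product using (Σ; _×_; ∃)
open import Data.Sum using (_⊎_)
open import Data.Unit using (⊤)
open import Function.Definitions using (Bijective)
open import Relation.Binary.PropositionalEquality using (_≡_; _≢_)

-- Simplicial complexes, given by their list of facets.
-- Vertices of a complex on n vertices are Fin n; the vertex with
-- paper-label v ∈ {1,…,n} is the element (v - 1) of Fin n.

setOf : ∀ {n} → List (Fin n) → Subset n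
setOf = foldr (λ x s → ⁅ x ⁆ ∪ s) ⊥

TightHamiltonian : (n d : ℕ) .{{_ : NonZero n}} → List (Subset n) → Set
TightHamiltonian n d facets =
  Σ (Fin n → Fin n) λ τ → Bijective _≡_ _≡_ τ ×
    ((i : Fin n) →
      setOf (map (λ t → τ ((toℕ i + t) mod n)) (upTo (suc d))) ∈ facets)

-- Dual graph: vertices are the facets (indices into the facet list), two
-- facets adjacent iff they share exactly d vertices (facets have d+1
-- vertices, so this is sharing a (d-1)-face; it excludes loops).

DualVertex : ∀ {n} → List (Subset n) → Set
DualVertex facets = Fin (length facets)

DualAdj : ∀ {n} (d : ℕ) (facets : List (Subset n)) →
          DualVertex facets → DualVertex facets → Set
DualAdj d facets a b = ∣ lookup facets a ∩ lookup facets b ∣ ≡ d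

data Walk {m : ℕ} (E : Fin m → Fin m → Set) (P : Fin m → Set) :
          Fin m → Fin m → Set where
  [_]  : ∀ {u} → P u → Walk E P u u
  step : ∀ {u v w} → P u → E u v → Walk E P v w → Walk E P u w

Connected : (m : ℕ) → (Fin m → Fin m → Set) → Set
Connected m E = (u w : Fin m) → Walk E (λ _ → ⊤) u w

TwoConnected : (m : ℕ) → (Fin m → Fin m → Set) → Set
TwoConnected m E =
  3 ≤ m × Connected m E ×
  ((v u w : Fin m) → u ≢ v → w ≢ v → Walk E (λ x → x ≢ v) u w)

CycSucc : (m : ℕ) → Fin m → Fin m → Set
CycSucc m i j = toℕ j ≡ suc (toℕ i) ⊎ (suc (toℕ i) ≡ m × toℕ j ≡ 0)

HamiltonianCycle : (m : ℕ) → (Fin m → Fin m → Set) → Set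
HamiltonianCycle m E =
  3 ≤ m × (Σ (Fin m → Fin m) λ π → Bijective _≡_ _≡_ π ×
    ((i j : Fin m) → CycSucc m i j → E (π i) (π j)))

HamiltonianPath : (m : ℕ) → (Fin m → Fin m → Set) → Set
HamiltonianPath m E =
  Σ (Fin m → Fin m) λ π → Bijective _≡_ _≡_ π ×
    ((i j : Fin m) → toℕ j ≡ suc (toℕ i) → E (π i) (π j))

module _ (d : ℕ) where

  nC : ℕ
  nC = 12 + d   -- n = d + 12 (written 12 + d so that it is visibly nonzero)

  -- vertex with paper-label x (taken mod n, labels 1..n)
  lab : ℕ → Fin nC
  lab x = (x + (nC ∸ 1)) mod nC

  range : ℕ → ℕ → List ℕ
  range a b = map (a +_) (upTo (suc b ∸ a))

  face : List ℕ → Subset nC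
  face xs = setOf (map lab xs)

  H : ℕ → Subset nC
  H i = face (map (i +_) (upTo (suc d)))

  F₁ F₂ F₃ F₄ : Subset nC
  F₁ = face (1 ∷ 5 ∷ range 7 (d + 5))
  F₂ = face (1 ∷ range 7 (d + 5) ++ (d + 7) ∷ [])
  F₃ = face (2 ∷ 8 ∷ range 10 (d + 8))
  F₄ = face (2 ∷ range 10 (d + 8) ++ (d + 10) ∷ [])

  facetsC : List (Subset nC)
  facetsC = map (λ k → H (suc k)) (upTo nC) ++ (F₁ ∷ F₂ ∷ F₃ ∷ F₄ ∷ [])

  dualC : Fin (length facetsC) → Fin (length facetsC) → Set
  dualC = DualAdj d facetsC

-- All facets have d + 1 vertices, so two of them are adjacent in the dual graph exactly when
-- all but one vertex of the first lies in the second: adjacency is witnessed by one vertex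
-- outside, non-adjacency by two.  Labelling the vertices 1, …, n in order makes H₁, …, Hₙ
-- a tight-Hamiltonian cycle.  In the dual graph H₉ H₈ F₃ F₄ H₁₀ … Hₙ H₁ … H₇ F₂ F₁ is a
-- Hamiltonian path, and the edges H₉H₁₀, H₈H₇ and H₅F₁ jump over each of its inner
-- positions, so deleting a vertex leaves it connected.  Finally H₆, F₁ and F₂ have only the
-- neighbours {H₅, H₇}, {H₅, F₂} and {F₁, H₇}, so a Hamiltonian cycle would contain the
-- 5-cycle H₅ H₆ H₇ F₂ F₁.

module Submission where

open import Defs
open import Data.Nat using (ℕ; zero; suc; _≤_; s≤s; NonZero)
open import Data.Fin using (Fin)
open import Data.List using (length)
open import Data.Product using (_×_; _,_)
open import Relation.Nullary using (¬_)

module SubsetCardinality where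

  open import Data.Nat using (suc; _+_)
  open import Data.Nat.Properties using (+-suc; +-comm; +-monoʳ-≤)
  open import Data.Fin using (Fin; zero; suc)
  import Data.Fin.Properties as Fin
  open import Data.Fin.Subset using (Subset; ⁅_⁆; _∪_; _∩_; ∣_∣; ∁; inside; outside; _∈_; _∉_; _⊆_)
  open import Data.Fin.Subset.Properties
  open import Data.Vec using ([]; _∷_; here; there)
  open import Data.List using (List; []; _∷_)
  import Data.List.Membership.Propositional as List
  open import Data.List.Relation.Unary.Any using (here; there)
  import Data.List.Relation.Unary.All as All
  open import Data.List.Relation.Unary.AllPairs using (_∷_)
  open import Data.List.Relation.Unary.Unique.Propositional using (Unique)
  open import Data.Sum using (inj₁; inj₂)
  open import Data.Product using (_,_)
  open import Data.Empty using (⊥-elim)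
  open import Relation.Nullary using (yes; no)
  open import Function using (_∘_)
  open import Relation.Binary.PropositionalEquality

  private variable k : ℕ

  ∣p∩q∣+∣p∩∁q∣≡∣p∣ : (p q : Subset k) → ∣ p ∩ q ∣ + ∣ p ∩ ∁ q ∣ ≡ ∣ p ∣
  ∣p∩q∣+∣p∩∁q∣≡∣p∣ []            []            = refl
  ∣p∩q∣+∣p∩∁q∣≡∣p∣ (inside  ∷ p) (inside  ∷ q) = cong suc (∣p∩q∣+∣p∩∁q∣≡∣p∣ p q)
  ∣p∩q∣+∣p∩∁q∣≡∣p∣ (inside  ∷ p) (outside ∷ q) = trans (+-suc _ _) (cong suc (∣p∩q∣+∣p∩∁q∣≡∣p∣ p q))
  ∣p∩q∣+∣p∩∁q∣≡∣p∣ (outside ∷ p) (inside  ∷ q) = ∣p∩q∣+∣p∩∁q∣≡∣p∣ p q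
  ∣p∩q∣+∣p∩∁q∣≡∣p∣ (outside ∷ p) (outside ∷ q) = ∣p∩q∣+∣p∩∁q∣≡∣p∣ p q

  x∉p⇒∣⁅x⁆∪p∣≡1+∣p∣ : (x : Fin k) (p : Subset k) → x ∉ p → ∣ ⁅ x ⁆ ∪ p ∣ ≡ suc ∣ p ∣
  x∉p⇒∣⁅x⁆∪p∣≡1+∣p∣ zero    (inside  ∷ p) x∉p = ⊥-elim (x∉p here)
  x∉p⇒∣⁅x⁆∪p∣≡1+∣p∣ zero    (outside ∷ p) x∉p = cong (suc ∘ ∣_∣) (∪-identityˡ p)
  x∉p⇒∣⁅x⁆∪p∣≡1+∣p∣ (suc x) (inside  ∷ p) x∉p = cong suc (x∉p⇒∣⁅x⁆∪p∣≡1+∣p∣ x p (x∉p ∘ there))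
  x∉p⇒∣⁅x⁆∪p∣≡1+∣p∣ (suc x) (outside ∷ p) x∉p = x∉p⇒∣⁅x⁆∪p∣≡1+∣p∣ x p (x∉p ∘ there)

  ∣p∩q∣+2≤∣p∣ : {p q : Subset k} {x y : Fin k} → x ≢ y →
                x ∈ p → y ∈ p → x ∉ q → y ∉ q → ∣ p ∩ q ∣ + 2 ≤ ∣ p ∣
  ∣p∩q∣+2≤∣p∣ {p = p} {q} {x} {y} x≢y x∈p y∈p x∉q y∉q =
    subst (∣ p ∩ q ∣ + 2 ≤_) (∣p∩q∣+∣p∩∁q∣≡∣p∣ p q)
      (+-monoʳ-≤ ∣ p ∩ q ∣ (subst (_≤ ∣ p ∩ ∁ q ∣) ∣⁅x⁆∪⁅y⁆∣≡2 (p⊆q⇒∣p∣≤∣q∣ ⁅x⁆∪⁅y⁆⊆p∖q)))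
    where
    ∣⁅x⁆∪⁅y⁆∣≡2 : ∣ ⁅ x ⁆ ∪ ⁅ y ⁆ ∣ ≡ 2
    ∣⁅x⁆∪⁅y⁆∣≡2 = trans (x∉p⇒∣⁅x⁆∪p∣≡1+∣p∣ x ⁅ y ⁆ (x≢y⇒x∉⁅y⁆ x≢y)) (cong suc (∣⁅x⁆∣≡1 y))
    ⁅x⁆∪⁅y⁆⊆p∖q : (⁅ x ⁆ ∪ ⁅ y ⁆) ⊆ (p ∩ ∁ q)
    ⁅x⁆∪⁅y⁆⊆p∖q z∈ with x∈p∪q⁻ ⁅ x ⁆ ⁅ y ⁆ z∈
    ... | inj₁ z∈⁅x⁆ rewrite x∈⁅y⁆⇒x≡y x z∈⁅x⁆ = x∈p∩q⁺ (x∈p , x∉p⇒x∈∁p x∉q)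
    ... | inj₂ z∈⁅y⁆ rewrite x∈⁅y⁆⇒x≡y y z∈⁅y⁆ = x∈p∩q⁺ (y∈p , x∉p⇒x∈∁p y∉q)

  1+∣p∩q∣≡∣p∣ : {p q : Subset k} {x : Fin k} → x ∈ p → x ∉ q →
                (∀ y → y ∈ p → y ≢ x → y ∈ q) → suc ∣ p ∩ q ∣ ≡ ∣ p ∣
  1+∣p∩q∣≡∣p∣ {p = p} {q} {x} x∈p x∉q rest = begin
    suc ∣ p ∩ q ∣           ≡⟨ +-comm 1 ∣ p ∩ q ∣ ⟩
    ∣ p ∩ q ∣ + 1           ≡⟨ cong (∣ p ∩ q ∣ +_) (sym ∣p∖q∣≡1) ⟩
    ∣ p ∩ q ∣ + ∣ p ∩ ∁ q ∣ ≡⟨ ∣p∩q∣+∣p∩∁q∣≡∣p∣ p q ⟩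
    ∣ p ∣                   ∎
    where
    open ≡-Reasoning
    p∖q⊆⁅x⁆ : (p ∩ ∁ q) ⊆ ⁅ x ⁆
    p∖q⊆⁅x⁆ {z} z∈ with x∈p∩q⁻ p (∁ q) z∈
    ... | z∈p , z∈∁q with z Fin.≟ x
    ...   | yes refl = x∈⁅x⁆ x
    ...   | no z≢x   = ⊥-elim (x∈p⇒x∉∁p (rest z z∈p z≢x) z∈∁q)
    ⁅x⁆⊆p∖q : ⁅ x ⁆ ⊆ (p ∩ ∁ q)
    ⁅x⁆⊆p∖q z∈ rewrite x∈⁅y⁆⇒x≡y x z∈ = x∈p∩q⁺ (x∈p , x∉p⇒x∈∁p x∉q)
    ∣p∖q∣≡1 : ∣ p ∩ ∁ q ∣ ≡ 1
    ∣p∖q∣≡1 = trans (cong ∣_∣ (⊆-antisym p∖q⊆⁅x⁆ ⁅x⁆⊆p∖q)) (∣⁅x⁆∣≡1 x)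

  ∈setOf⁺ : {x : Fin k} {xs : List (Fin k)} → x List.∈ xs → x ∈ setOf xs
  ∈setOf⁺ {xs = y ∷ xs} (here refl) = x∈p∪q⁺ (inj₁ (x∈⁅x⁆ y))
  ∈setOf⁺ {xs = y ∷ xs} (there x∈)  = x∈p∪q⁺ (inj₂ (∈setOf⁺ x∈))

  ∈setOf⁻ : {x : Fin k} {xs : List (Fin k)} → x ∈ setOf xs → x List.∈ xs
  ∈setOf⁻ {xs = []}     x∈ = ⊥-elim (∉⊥ x∈)
  ∈setOf⁻ {xs = y ∷ xs} x∈ with x∈p∪q⁻ ⁅ y ⁆ (setOf xs) x∈
  ... | inj₁ x∈⁅y⁆ = here (x∈⁅y⁆⇒x≡y y x∈⁅y⁆)
  ... | inj₂ x∈xs  = there (∈setOf⁻ x∈xs)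

  ∣setOf∣≡length : (xs : List (Fin k)) → Unique xs → ∣ setOf xs ∣ ≡ length xs
  ∣setOf∣≡length {k} [] _ = ∣⊥∣≡0 k
  ∣setOf∣≡length (x ∷ xs) (x≢xs ∷ xs!) =
    trans (x∉p⇒∣⁅x⁆∪p∣≡1+∣p∣ x (setOf xs) (λ x∈ → All.lookup x≢xs (∈setOf⁻ x∈) refl))
          (cong suc (∣setOf∣≡length xs xs!))

module ListIndexing where

  open import Data.Nat using (zero; suc; _+_; _<_; z≤n; s≤s)
  open import Data.Fin using (Fin; zero; suc; toℕ; fromℕ<)
  import Data.Fin.Properties as Fin
  open import Data.List using (List; []; _∷_; _++_; applyUpTo; lookup)
  open import Data.List.Membership.Propositional using (_∈_)
  open import Data.List.Relation.Unary.Any using (here; there)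
  import Data.List.Relation.Unary.All as All
  open import Data.List.Relation.Unary.All using (All)
  open import Data.List.Relation.Unary.AllPairs using (_∷_)
  open import Data.List.Relation.Unary.Unique.Propositional using (Unique)
  open import Data.List.Relation.Unary.Linked using (Linked; [-]; _∷_)
  open import Data.Product using (Σ; _×_; _,_)
  open import Relation.Nullary using (contradiction)
  open import Relation.Binary.PropositionalEquality
  open import Function.Definitions using (Injective; Surjective)

  private variable A : Set

  nth : List A → ℕ → A → A
  nth []       _       z = z
  nth (x ∷ xs) zero    z = x
  nth (x ∷ xs) (suc j) z = nth xs j z

  lookup≡nth : (xs : List A) (i : Fin (length xs)) (z : A) → lookup xs i ≡ nth xs (toℕ i) z
  lookup≡nth (x ∷ xs) zero    z = refl
  lookup≡nth (x ∷ xs) (suc i) z = lookup≡nth xs i z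

  nth-++ˡ : (xs ys : List A) (j : ℕ) (z : A) → j < length xs → nth (xs ++ ys) j z ≡ nth xs j z
  nth-++ˡ (x ∷ xs) ys zero    z _         = refl
  nth-++ˡ (x ∷ xs) ys (suc j) z (s≤s j<) = nth-++ˡ xs ys j z j<

  nth-++ʳ : (xs ys : List A) (j : ℕ) (z : A) → nth (xs ++ ys) (length xs + j) z ≡ nth ys j z
  nth-++ʳ []       ys j z = refl
  nth-++ʳ (x ∷ xs) ys j z = nth-++ʳ xs ys j z

  nth-applyUpTo : (f : ℕ → A) (k j : ℕ) (z : A) → j < k → nth (applyUpTo f k) j z ≡ f j
  nth-applyUpTo f (suc k) zero    z _         = refl
  nth-applyUpTo f (suc k) (suc j) z (s≤s j<) = nth-applyUpTo (λ t → f (suc t)) k j z j<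

  nth-∈ : ∀ {xs : List A} {i} z → i < length xs → nth xs i z ∈ xs
  nth-∈ {xs = x ∷ xs} {zero}  z _        = here refl
  nth-∈ {xs = x ∷ xs} {suc i} z (s≤s i<) = there (nth-∈ z i<)

  ∈⇒nth : ∀ {xs : List A} {x} z → x ∈ xs → Σ ℕ λ i → i < length xs × nth xs i z ≡ x
  ∈⇒nth z (here refl) = 0 , s≤s z≤n , refl
  ∈⇒nth z (there x∈) with ∈⇒nth z x∈
  ... | i , i< , nth≡x = suc i , s≤s i< , nth≡x

  nth-injective : ∀ {xs : List A} {i j} z → Unique xs → i < length xs → j < length xs →
                  nth xs i z ≡ nth xs j z → i ≡ j
  nth-injective {xs = x ∷ xs} {zero}  {zero}  z _            _        _        _  = refl
  nth-injective {xs = x ∷ xs} {zero}  {suc j} z (x≢xs ∷ _)  _        (s≤s j<) eq =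
    contradiction eq (All.lookup x≢xs (nth-∈ z j<))
  nth-injective {xs = x ∷ xs} {suc i} {zero}  z (x≢xs ∷ _)  (s≤s i<) _        eq =
    contradiction (sym eq) (All.lookup x≢xs (nth-∈ z i<))
  nth-injective {xs = x ∷ xs} {suc i} {suc j} z (_ ∷ xs!)   (s≤s i<) (s≤s j<) eq =
    cong suc (nth-injective z xs! i< j< eq)

  nth-Linked : ∀ {R : A → A → Set} {xs i} z → Linked R xs → suc i < length xs → R (nth xs i z) (nth xs (suc i) z)
  nth-Linked {i = zero}  z (Rxy ∷ _)    _           = Rxy
  nth-Linked {i = suc i} z (_ ∷ linked) (s≤s i+1<) = nth-Linked z linked i+1<
  nth-Linked             z [-]          (s≤s ())

  module ListPermutation {m : ℕ} (xs : List ℕ) (length≡ : length xs ≡ m) (unique : Unique xs)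
                         (bounded : All (_< m) xs) (complete : ∀ {j} → j < m → j ∈ xs) where

    private
      at : ∀ {i} → i < m → nth xs i 0 < m
      at i<m = All.lookup bounded (nth-∈ 0 (subst (_ <_) (sym length≡) i<m))

    permutation : Fin m → Fin m
    permutation i = fromℕ< (at (Fin.toℕ<n i))

    toℕ-permutation : ∀ i → toℕ (permutation i) ≡ nth xs (toℕ i) 0
    toℕ-permutation i = Fin.toℕ-fromℕ< _

    permutation-injective : Injective _≡_ _≡_ permutation
    permutation-injective {i} {j} eq = Fin.toℕ-injective (nth-injective 0 unique (in-range i) (in-range j)
      (trans (sym (toℕ-permutation i)) (trans (cong toℕ eq) (toℕ-permutation j))))
      where
      in-range : ∀ k → toℕ k < length xs
      in-range k = subst (_ <_) (sym length≡) (Fin.toℕ<n k)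

    permutation-surjective : Surjective _≡_ _≡_ permutation
    permutation-surjective j with ∈⇒nth 0 (complete (Fin.toℕ<n j))
    ... | i , i< , nth≡j = fromℕ< (subst (_ <_) length≡ i<) , λ { refl → Fin.toℕ-injective (begin
      toℕ (permutation (fromℕ< _))   ≡⟨ toℕ-permutation _ ⟩
      nth xs (toℕ (fromℕ< _)) 0       ≡⟨ cong (λ k → nth xs k 0) (Fin.toℕ-fromℕ< _) ⟩
      nth xs i 0                      ≡⟨ nth≡j ⟩
      toℕ j                           ∎) }
      where open ≡-Reasoning

module Intervals where

  open import Data.Nat using (zero; suc; _+_; _<_; _∸_; s≤s)
  open import Data.Nat.Properties
  open import Data.List using (List; []; _∷_; _++_; map; upTo; applyUpTo)
  open import Data.List.Relation.Unary.Linked using (Linked; _∷_)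
  open import Data.List.Properties using (map-upTo)
  open import Data.List.Membership.Propositional using (_∈_)
  open import Data.List.Relation.Unary.Any using (here; there)
  import Data.List.Relation.Unary.All as All
  open import Data.List.Relation.Unary.AllPairs using (AllPairs; []; _∷_)
  open import Data.Product using (Σ; _×_; _,_; proj₁)
  open import Data.Sum using (inj₁; inj₂)
  open import Relation.Nullary using (contradiction)
  open import Relation.Binary.PropositionalEquality

  interval : ℕ → ℕ → List ℕ
  interval a zero    = []
  interval a (suc c) = a ∷ interval (suc a) c

  map-upTo≡interval : (a c : ℕ) → map (a +_) (upTo c) ≡ interval a c
  map-upTo≡interval a c = trans (map-upTo (a +_) c) (applyUpTo≡interval (a +_) a c (λ _ → refl))
    where
    applyUpTo≡interval : ∀ f a c → (∀ t → f t ≡ a + t) → applyUpTo f c ≡ interval a c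
    applyUpTo≡interval f a zero    f≗ = refl
    applyUpTo≡interval f a (suc c) f≗ = cong₂ _∷_ (trans (f≗ 0) (+-identityʳ a))
      (applyUpTo≡interval (λ t → f (suc t)) (suc a) c (λ t → trans (f≗ (suc t)) (+-suc a t)))

  length-interval : (a c : ℕ) → length (interval a c) ≡ c
  length-interval a zero    = refl
  length-interval a (suc c) = cong suc (length-interval (suc a) c)

  ∈-interval⁻ : ∀ {a c x} → x ∈ interval a c → a ≤ x × x < a + c
  ∈-interval⁻ {a} {suc c} (here refl) = ≤-refl , subst (a <_) (sym (+-suc a c)) (s≤s (m≤m+n a c))
  ∈-interval⁻ {a} {suc c} {x} (there x∈) with ∈-interval⁻ x∈
  ... | a<x , x< = <⇒≤ a<x , subst (x <_) (sym (+-suc a c)) x<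

  ∈-interval⁺ : ∀ {a c x} → a ≤ x → x < a + c → x ∈ interval a c
  ∈-interval⁺ {a} {zero} {x} a≤x x< = contradiction (subst (x <_) (+-identityʳ a) x<) (≤⇒≯ a≤x)
  ∈-interval⁺ {a} {suc c} {x} a≤x x< with m≤n⇒m<n∨m≡n a≤x
  ... | inj₂ refl = here refl
  ... | inj₁ a<x  = there (∈-interval⁺ a<x (subst (x <_) (+-suc a c) x<))

  +-∈-interval : ∀ {a c t} → t < c → a + t ∈ interval a c
  +-∈-interval {a} t<c = ∈-interval⁺ (m≤m+n a _) (+-monoʳ-< a t<c)

  ∈-interval-shift⁻ : ∀ {k a c x} → x ∈ interval (k + a) c → Σ ℕ λ t → x ≡ k + t × t ∈ interval a c
  ∈-interval-shift⁻ {k} {a} {c} {x} x∈ with ∈-interval⁻ x∈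
  ... | k+a≤x , x< = x ∸ k , sym k+t≡x ,
        ∈-interval⁺ (+-cancelˡ-≤ k a _ (subst (k + a ≤_) (sym k+t≡x) k+a≤x))
                    (+-cancelˡ-< k _ _ (subst₂ _<_ (sym k+t≡x) (+-assoc k a c) x<))
    where
    k+t≡x : k + (x ∸ k) ≡ x
    k+t≡x = m+[n∸m]≡n (≤-trans (m≤m+n k a) k+a≤x)

  interval-mono : ∀ {a c c' x} → c ≤ c' → x ∈ interval a c → x ∈ interval a c'
  interval-mono {a} c≤c' x∈ with ∈-interval⁻ x∈
  ... | a≤x , x< = ∈-interval⁺ a≤x (<-≤-trans x< (+-monoʳ-≤ a c≤c'))

  Linked-interval-++ : ∀ {R : ℕ → ℕ → Set} {a c y ys} → (∀ {k} → a ≤ k → k < a + c → R k (suc k)) →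
                      R (a + c) y → Linked R (y ∷ ys) → Linked R (interval a (suc c) ++ y ∷ ys)
  Linked-interval-++ {R} {a} {zero}  {y} _     R[a+c]y linked = subst (λ k → R k y) (+-identityʳ a) R[a+c]y ∷ linked
  Linked-interval-++ {R} {a} {suc c} {y} steps R[a+c]y linked =
    steps ≤-refl (subst (a <_) (sym (+-suc a c)) (s≤s (m≤m+n a c)))
    ∷ Linked-interval-++ (λ {k} a<k k< → steps (<⇒≤ a<k) (subst (k <_) (sym (+-suc a c)) k<))
                         (subst (λ k → R k y) (+-suc a c) R[a+c]y) linked

  interval-sorted : (a c : ℕ) → AllPairs _<_ (interval a c)
  interval-sorted a zero    = []
  interval-sorted a (suc c) = All.tabulate (λ x∈ → proj₁ (∈-interval⁻ x∈)) ∷ interval-sorted (suc a) c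

module Modular where

  open import Data.Nat using (suc; _+_; _*_; _<_; NonZero; _%_; _/_)
  open import Data.Nat.Properties
  open import Data.Nat.DivMod using (m≡m%n+[m/n]*n)
  open import Relation.Binary.PropositionalEquality

  m%n≡o%n∧m≤o<m+n⇒m≡o : ∀ m o n .{{_ : NonZero n}} → m % n ≡ o % n → m ≤ o → o < m + n → m ≡ o
  m%n≡o%n∧m≤o<m+n⇒m≡o m o n m%≡o% m≤o o<m+n = begin
    m                 ≡⟨ m≡ ⟩
    r + (m / n) * n   ≡⟨ cong (λ q → r + q * n) m/n≡o/n ⟩
    r + (o / n) * n   ≡⟨ sym o≡ ⟩
    o                 ∎
    where
    open ≡-Reasoning
    r = o % n
    m≡ : m ≡ r + (m / n) * n
    m≡ = trans (m≡m%n+[m/n]*n m n) (cong (_+ (m / n) * n) m%≡o%)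
    o≡ : o ≡ r + (o / n) * n
    o≡ = m≡m%n+[m/n]*n o n
    lower : (m / n) * n ≤ (o / n) * n
    lower = +-cancelˡ-≤ r _ _ (subst₂ _≤_ m≡ o≡ m≤o)
    upper : (o / n) * n < suc (m / n) * n
    upper = +-cancelˡ-< r _ _ (subst₂ _<_ o≡ (trans (cong (_+ n) m≡) (trans (+-assoc r _ n) (cong (r +_) (+-comm _ n)))) o<m+n)
    m/n≡o/n : m / n ≡ o / n
    m/n≡o/n = ≤-antisym (*-cancelʳ-≤ _ _ n lower) (≤-pred (*-cancelʳ-< n _ _ upper))

module Rotation (m : ℕ) .{{_ : NonZero m}} where

  open import Data.Nat using (zero; suc; pred; _+_; _<_; _%_; _≟_; _<?_; s≤s; ≢-nonZero)
  open import Data.Nat.Properties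
  open import Data.Nat.DivMod
  open import Data.Fin using (toℕ; fromℕ<)
  import Data.Fin.Properties as Fin
  open import Data.Product using (Σ; _,_)
  open import Data.Sum using (inj₁; inj₂)
  open import Relation.Nullary using (yes; no)
  open import Relation.Binary.PropositionalEquality
  open import Function.Definitions using (Injective)
  open Modular

  rotate : Fin m → Fin m
  rotate i = suc (toℕ i) mod m

  toℕ-rotate : ∀ i → toℕ (rotate i) ≡ suc (toℕ i) % m
  toℕ-rotate i = Fin.toℕ-fromℕ< _

  rotate-cyclic : ∀ i → CycSucc m i (rotate i)
  rotate-cyclic i with suc (toℕ i) <? m
  ... | yes i+1<m = inj₁ (trans (toℕ-rotate i) (m<n⇒m%n≡m i+1<m))
  ... | no  i+1≮m = inj₂ (i+1≡m , trans (toℕ-rotate i) (trans (cong (_% m) i+1≡m) (n%n≡0 m)))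
    where
    i+1≡m : suc (toℕ i) ≡ m
    i+1≡m = ≤-antisym (Fin.toℕ<n i) (≮⇒≥ i+1≮m)

  rotate-injective : Injective _≡_ _≡_ rotate
  rotate-injective {i} {j} eq = Fin.toℕ-injective (suc-injective (by-order (≤-total (toℕ i) (toℕ j))))
    where
    i+1%≡j+1% : suc (toℕ i) % m ≡ suc (toℕ j) % m
    i+1%≡j+1% = trans (sym (toℕ-rotate i)) (trans (cong toℕ eq) (toℕ-rotate j))
    by-order : _ → suc (toℕ i) ≡ suc (toℕ j)
    by-order (inj₁ i≤j) = m%n≡o%n∧m≤o<m+n⇒m≡o _ _ m i+1%≡j+1% (s≤s i≤j)
                            (s≤s (<-≤-trans (Fin.toℕ<n j) (m≤n+m m (toℕ i))))
    by-order (inj₂ j≤i) = sym (m%n≡o%n∧m≤o<m+n⇒m≡o _ _ m (sym i+1%≡j+1%) (s≤s j≤i)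
                            (s≤s (<-≤-trans (Fin.toℕ<n i) (m≤n+m m (toℕ j)))))

  rotate-surjective : ∀ j → Σ (Fin m) λ i → rotate i ≡ j
  rotate-surjective j with toℕ j ≟ 0
  ... | yes j≡0 = fromℕ< m-1<m , Fin.toℕ-injective (begin
        toℕ (rotate (fromℕ< m-1<m)) ≡⟨ toℕ-rotate _ ⟩
        suc (toℕ (fromℕ< m-1<m)) % m ≡⟨ cong (λ z → suc z % m) (Fin.toℕ-fromℕ< m-1<m) ⟩
        suc (pred m) % m             ≡⟨ cong (_% m) (suc-pred m) ⟩
        m % m                        ≡⟨ n%n≡0 m ⟩
        0                            ≡⟨ sym j≡0 ⟩
        toℕ j                        ∎)
    where
    open ≡-Reasoning
    m-1<m : pred m < m
    m-1<m = ≤-reflexive (suc-pred m)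
  ... | no j≢0 = fromℕ< j-1<m , Fin.toℕ-injective (begin
        toℕ (rotate (fromℕ< j-1<m)) ≡⟨ toℕ-rotate _ ⟩
        suc (toℕ (fromℕ< j-1<m)) % m ≡⟨ cong (λ z → suc z % m) (Fin.toℕ-fromℕ< j-1<m) ⟩
        suc (pred (toℕ j)) % m       ≡⟨ cong (_% m) (suc-pred (toℕ j) {{≢-nonZero j≢0}}) ⟩
        toℕ j % m                    ≡⟨ m<n⇒m%n≡m (Fin.toℕ<n j) ⟩
        toℕ j                        ∎)
    where
    open ≡-Reasoning
    j-1<m : pred (toℕ j) < m
    j-1<m = ≤-<-trans pred[n]≤n (Fin.toℕ<n j)

  rotate^ : ℕ → Fin m → Fin m
  rotate^ zero    i = i
  rotate^ (suc k) i = rotate (rotate^ k i)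

  toℕ-rotate^ : ∀ k i → toℕ (rotate^ k i) ≡ (toℕ i + k) % m
  toℕ-rotate^ zero    i = trans (sym (m<n⇒m%n≡m (Fin.toℕ<n i))) (cong (_% m) (sym (+-identityʳ _)))
  toℕ-rotate^ (suc k) i = begin
    toℕ (rotate (rotate^ k i))     ≡⟨ toℕ-rotate (rotate^ k i) ⟩
    suc (toℕ (rotate^ k i)) % m    ≡⟨ cong (λ z → suc z % m) (toℕ-rotate^ k i) ⟩
    suc ((toℕ i + k) % m) % m      ≡⟨ %-distribˡ-+ 1 ((toℕ i + k) % m) m ⟩
    (1 % m + (toℕ i + k) % m % m) % m ≡⟨ cong (λ z → (1 % m + z) % m) (m%n%n≡m%n (toℕ i + k) m) ⟩
    (1 % m + (toℕ i + k) % m) % m ≡⟨ sym (%-distribˡ-+ 1 (toℕ i + k) m) ⟩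
    suc (toℕ i + k) % m            ≡⟨ cong (_% m) (sym (+-suc (toℕ i) k)) ⟩
    (toℕ i + suc k) % m            ∎
    where open ≡-Reasoning

  rotate^-no-fixpoint : ∀ k i → 0 < k → k < m → rotate^ k i ≢ i
  rotate^-no-fixpoint k i 0<k k<m eq = <⇒≢ 0<k (sym (+-cancelˡ-≡ (toℕ i) k 0 (trans (sym i≡i+k) (sym (+-identityʳ _)))))
    where
    i≡i+k : toℕ i ≡ toℕ i + k
    i≡i+k = m%n≡o%n∧m≤o<m+n⇒m≡o (toℕ i) (toℕ i + k) m
              (trans (m<n⇒m%n≡m (Fin.toℕ<n i)) (trans (sym (cong toℕ eq)) (toℕ-rotate^ k i)))
              (m≤m+n _ _) (+-monoʳ-< (toℕ i) k<m)

module Graphs {m : ℕ} (E : Fin m → Fin m → Set) (E-sym : ∀ {a b} → E a b → E b a) where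

  open import Data.Nat using (zero; suc; _+_; _∸_; _<_; z≤n; s≤s; >-nonZero)
  open import Data.Nat.Properties
  open import Data.Fin using (toℕ; fromℕ<)
  import Data.Fin.Properties as Fin
  open import Data.Product using (∃₂; _×_; _,_; proj₁; proj₂)
  open import Data.Sum using (_⊎_; inj₁; inj₂)
  open import Data.Empty using (⊥)
  open import Relation.Nullary using (¬_; contradiction)
  open import Relation.Binary.PropositionalEquality
  open import Relation.Binary.Definitions using (tri<; tri≈; tri>)
  open import Function.Definitions using (Injective; Surjective; Bijective)
  open import Function using (_∘_)

  private variable P : Fin m → Set

  Walk-head : ∀ {u w} → Walk E P u w → P u
  Walk-head [ pu ]         = pu
  Walk-head (step pu _ _) = pu

  _++ᵂ_ : ∀ {u v w} → Walk E P u v → Walk E P v w → Walk E P u w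
  [ _ ]            ++ᵂ vw = vw
  step pu uu' u'v ++ᵂ vw = step pu uu' (u'v ++ᵂ vw)

  reverseᵂ : ∀ {u w} → Walk E P u w → Walk E P w u
  reverseᵂ [ pu ]             = [ pu ]
  reverseᵂ (step pu uv vw) = reverseᵂ vw ++ᵂ step (Walk-head vw) (E-sym uv) [ pu ]

  NeighboursIn : Fin m → Fin m → Fin m → Set
  NeighboursIn a b c = ∀ x → E a x → x ≡ b ⊎ x ≡ c

  module HamiltonianPathWalks (π : Fin m → Fin m) (π-injective : Injective _≡_ _≡_ π)
                              (π-surjective : Surjective _≡_ _≡_ π)
                              (π-adjacent : ∀ i j → toℕ j ≡ suc (toℕ i) → E (π i) (π j)) where

    position : Fin m → Fin m
    position v = proj₁ (π-surjective v)

    π-position : ∀ v → π (position v) ≡ v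
    π-position v = proj₂ (π-surjective v) refl

    walkUp : ∀ c (i j : Fin m) → toℕ j ≡ toℕ i + c →
             (∀ k → toℕ i ≤ toℕ k → toℕ k ≤ toℕ j → P (π k)) → Walk E P (π i) (π j)
    walkUp zero i j j≡ P-between
      rewrite Fin.toℕ-injective {i = j} {j = i} (trans j≡ (+-identityʳ _)) = [ P-between i ≤-refl ≤-refl ]
    walkUp {P = P} (suc c) i j j≡ P-between =
      step (P-between i ≤-refl (subst (toℕ i ≤_) (sym j≡) (m≤m+n _ _))) (π-adjacent i i' toℕi')
           (walkUp c i' j (trans j≡ (trans (+-suc (toℕ i) c) (cong (_+ c) (sym toℕi')))) P-between')
      where
      i'<m : suc (toℕ i) < m
      i'<m = ≤-<-trans (subst (suc (toℕ i) ≤_) (trans (sym (+-suc (toℕ i) c)) (sym j≡)) (s≤s (m≤m+n _ c)))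
                        (Fin.toℕ<n j)
      i' = fromℕ< i'<m
      toℕi' : toℕ i' ≡ suc (toℕ i)
      toℕi' = Fin.toℕ-fromℕ< i'<m
      P-between' : ∀ k → toℕ i' ≤ toℕ k → toℕ k ≤ toℕ j → P (π k)
      P-between' k i'≤k = P-between k (≤-trans (n≤1+n _) (subst (_≤ toℕ k) toℕi' i'≤k))

    Between : Fin m → Fin m → Fin m → Set
    Between i j k = (toℕ i ≤ toℕ k × toℕ k ≤ toℕ j) ⊎ (toℕ j ≤ toℕ k × toℕ k ≤ toℕ i)

    walkBetween : ∀ i j → (∀ k → Between i j k → P (π k)) → Walk E P (π i) (π j)
    walkBetween i j P-between with ≤-total (toℕ i) (toℕ j)
    ... | inj₁ i≤j = walkUp (toℕ j ∸ toℕ i) i j (sym (m+[n∸m]≡n i≤j)) (λ k l u → P-between k (inj₁ (l , u)))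
    ... | inj₂ j≤i = reverseᵂ (walkUp (toℕ i ∸ toℕ j) j i (sym (m+[n∸m]≡n j≤i)) (λ k l u → P-between k (inj₂ (l , u))))

    connected : Connected m E
    connected u w = subst₂ (Walk E _) (π-position u) (π-position w) (walkBetween (position u) (position w) _)

    Bypass : Fin m → Set
    Bypass q = ∃₂ λ a b → toℕ a < toℕ q × toℕ q < toℕ b × E (π a) (π b)

    -- Deleting π q cuts the path into two segments, and a bypass over q joins them.
    module _ (q : Fin m) (bypass : 0 < toℕ q → suc (toℕ q) < m → Bypass q) where

      private
        avoids : ∀ k → toℕ k ≢ toℕ q → π k ≢ π q
        avoids k k≢q πk≡πq = k≢q (cong toℕ (π-injective πk≡πq))

        SameSide : Fin m → Fin m → Set
        SameSide x y = (toℕ x < toℕ q × toℕ y < toℕ q) ⊎ (toℕ q < toℕ x × toℕ q < toℕ y)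

        k≢q : ∀ {x y k} → Between x y k → SameSide x y → toℕ k ≢ toℕ q
        k≢q (inj₁ (_ , k≤y)) (inj₁ (_ , y<q)) = <⇒≢ (≤-<-trans k≤y y<q)
        k≢q (inj₂ (_ , k≤x)) (inj₁ (x<q , _)) = <⇒≢ (≤-<-trans k≤x x<q)
        k≢q (inj₁ (x≤k , _)) (inj₂ (q<x , _)) = >⇒≢ (<-≤-trans q<x x≤k)
        k≢q (inj₂ (y≤k , _)) (inj₂ (_ , q<y)) = >⇒≢ (<-≤-trans q<y y≤k)

        sameSide : ∀ x y → SameSide x y → Walk E (_≢ π q) (π x) (π y)
        sameSide x y side = walkBetween x y (λ k between → avoids k (k≢q between side))

        across : ∀ x y → toℕ x < toℕ q → toℕ q < toℕ y → Walk E (_≢ π q) (π x) (π y)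
        across x y x<q q<y with bypass (≤-<-trans z≤n x<q) (<-≤-trans (s≤s q<y) (Fin.toℕ<n y))
        ... | a , b , a<q , q<b , πa~πb =
          sameSide x a (inj₁ (x<q , a<q)) ++ᵂ step (avoids a (<⇒≢ a<q)) πa~πb (sameSide b y (inj₂ (q<b , q<y)))

      walkAvoiding : ∀ x y → toℕ x ≢ toℕ q → toℕ y ≢ toℕ q → Walk E (_≢ π q) (π x) (π y)
      walkAvoiding x y x≢q y≢q with <-cmp (toℕ x) (toℕ q) | <-cmp (toℕ y) (toℕ q)
      ... | tri< x<q _ _ | tri< y<q _ _ = sameSide x y (inj₁ (x<q , y<q))
      ... | tri> _ _ q<x | tri> _ _ q<y = sameSide x y (inj₂ (q<x , q<y))
      ... | tri< x<q _ _ | tri> _ _ q<y = across x y x<q q<y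
      ... | tri> _ _ q<x | tri< y<q _ _ = reverseᵂ (across y x y<q q<x)
      ... | tri≈ _ x≡q _ | _            = contradiction x≡q x≢q
      ... | _            | tri≈ _ y≡q _ = contradiction y≡q y≢q

    bypasses⇒twoConnected : 3 ≤ m → (∀ q → 0 < toℕ q → suc (toℕ q) < m → Bypass q) → TwoConnected m E
    bypasses⇒twoConnected 3≤m bypass = 3≤m , connected , λ v u w u≢v w≢v →
      subst₂ (Walk E (_≢ v)) (π-position u) (π-position w)
        (subst (λ z → Walk E (_≢ z) (π (position u)) (π (position w))) (π-position v)
          (walkAvoiding (position v) (bypass (position v)) (position u) (position w)
            (position-≢ u≢v) (position-≢ w≢v)))
      where
      position-≢ : ∀ {u v} → u ≢ v → toℕ (position u) ≢ toℕ (position v)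
      position-≢ {u} {v} u≢v eq =
        u≢v (trans (sym (π-position u)) (trans (cong π (Fin.toℕ-injective eq)) (π-position v)))

  module HamiltonianCycleSuccessor .{{_ : NonZero m}} (π : Fin m → Fin m) (π-bijective : Bijective _≡_ _≡_ π)
                                   (π-cyclic : ∀ i j → CycSucc m i j → E (π i) (π j)) where

    open Rotation m

    private
      π-injective = proj₁ π-bijective

      position : Fin m → Fin m
      position v = proj₁ (proj₂ π-bijective v)

      π-position : ∀ v → π (position v) ≡ v
      π-position v = proj₂ (proj₂ π-bijective v) refl

    next : Fin m → Fin m
    next v = π (rotate (position v))

    next-adjacent : ∀ v → E v (next v)
    next-adjacent v = subst (λ u → E u (next v)) (π-position v) (π-cyclic _ _ (rotate-cyclic (position v)))

    next-π : ∀ i → next (π i) ≡ π (rotate i)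
    next-π i = cong (π ∘ rotate) (π-injective (π-position (π i)))

    next-injective : Injective _≡_ _≡_ next
    next-injective {u} {v} eq =
      trans (sym (π-position u)) (trans (cong π (rotate-injective (π-injective eq))) (π-position v))

    previous : Fin m → Fin m
    previous v = π (proj₁ (rotate-surjective (position v)))

    next-previous : ∀ v → next (previous v) ≡ v
    next-previous v = trans (next-π _) (trans (cong π (proj₂ (rotate-surjective (position v)))) (π-position v))

    next^ : ℕ → Fin m → Fin m
    next^ zero    v = v
    next^ (suc k) v = next (next^ k v)

    next^-π : ∀ k i → next^ k (π i) ≡ π (rotate^ k i)
    next^-π zero    i = refl
    next^-π (suc k) i = trans (cong next (next^-π k i)) (next-π (rotate^ k i))

    next^-no-fixpoint : ∀ k v → 0 < k → k < m → next^ k v ≢ v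
    next^-no-fixpoint k v 0<k k<m eq = rotate^-no-fixpoint k (position v) 0<k k<m (π-injective (begin
      π (rotate^ k (position v)) ≡⟨ sym (next^-π k (position v)) ⟩
      next^ k (π (position v))   ≡⟨ cong (next^ k) (π-position v) ⟩
      next^ k v                  ≡⟨ eq ⟩
      v                          ≡⟨ sym (π-position v) ⟩
      π (position v)             ∎))
      where open ≡-Reasoning

    next∈ : ∀ {v b c} → NeighboursIn v b c → next v ≡ b ⊎ next v ≡ c
    next∈ {v} v~ = v~ (next v) (next-adjacent v)

    previous∈ : ∀ {v b c} → NeighboursIn v b c → previous v ≡ b ⊎ previous v ≡ c
    previous∈ {v} v~ = v~ (previous v) (E-sym (subst (E (previous v)) (next-previous v) (next-adjacent (previous v))))

  -- Since b, f and g have at most two neighbours, a Hamiltonian cycle has to run through the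
  -- pentagon a b c g f, which closes up after five steps although m > 5.
  ¬HamiltonianCycle-pentagon : 6 ≤ m → ∀ {a b c f g} → f ≢ b → f ≢ c → g ≢ b → g ≢ a →
    NeighboursIn b a c → NeighboursIn f a g → NeighboursIn g f c → ¬ HamiltonianCycle m E
  ¬HamiltonianCycle-pentagon 6≤m {a} {b} {c} {f} {g} f≢b f≢c g≢b g≢a b~ f~ g~ (3≤m , π , π-bijective , π-cyclic) =
    orient (next∈ b~)
    where
    instance
      m≢0 : NonZero m
      m≢0 = >-nonZero (<-≤-trans (s≤s z≤n) 3≤m)
    open HamiltonianCycleSuccessor π π-bijective π-cyclic

    no-2-cycle : ∀ v → next (next v) ≢ v
    no-2-cycle v = next^-no-fixpoint 2 v (s≤s z≤n) (<-≤-trans (s≤s (s≤s (s≤s z≤n))) 6≤m)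

    no-5-cycle : ∀ {v₁ v₂ v₃ v₄ v₅} → next v₁ ≡ v₂ → next v₂ ≡ v₃ → next v₃ ≡ v₄ → next v₄ ≡ v₅ → next v₅ ≡ v₁ → ⊥
    no-5-cycle {v₁} refl refl refl refl eq = next^-no-fixpoint 5 v₁ (s≤s z≤n) 6≤m eq

    next-from-previous : ∀ {u v} → previous v ≡ u → next u ≡ v
    next-from-previous {v = v} refl = next-previous v

    orient : next b ≡ a ⊎ next b ≡ c → ⊥
    orient (inj₁ b→a) with next∈ f~
    ... | inj₁ f→a = f≢b (next-injective (trans f→a (sym b→a)))
    ... | inj₂ f→g with next∈ g~
    ...   | inj₁ g→f = no-2-cycle f (trans (cong next f→g) g→f)
    ...   | inj₂ g→c with previous∈ f~
    ...     | inj₂ g←f = f≢c (trans (sym (next-from-previous g←f)) g→c)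
    ...     | inj₁ a←f with previous∈ b~
    ...       | inj₁ a←b = f≢b (trans (sym (next-from-previous a←f)) (next-from-previous a←b))
    ...       | inj₂ c←b = no-5-cycle b→a (next-from-previous a←f) f→g g→c (next-from-previous c←b)
    orient (inj₂ b→c) with next∈ g~
    ... | inj₂ g→c = g≢b (next-injective (trans g→c (sym b→c)))
    ... | inj₁ g→f with next∈ f~
    ...   | inj₂ f→g = no-2-cycle g (trans (cong next g→f) f→g)
    ...   | inj₁ f→a with previous∈ g~
    ...     | inj₁ f←g = g≢a (trans (sym (next-from-previous f←g)) f→a)
    ...     | inj₂ c←g with previous∈ b~
    ...       | inj₂ c←b = g≢b (trans (sym (next-from-previous c←g)) (next-from-previous c←b))
    ...       | inj₁ a←b = no-5-cycle b→c (next-from-previous c←g) g→f f→a (next-from-previous a←b)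

module Labels (e : ℕ) where

  open import Data.Nat using (suc; _+_; _∸_; _<_; _%_; _≤ᵇ_; s≤s)
  open import Data.Nat.Properties
  open import Data.Nat.DivMod using ([m+n]%n≡m%n)
  open import Data.Bool using (T)
  open import Data.Fin using (toℕ)
  import Data.Fin.Properties as Fin
  open import Data.Fin.Subset using (Subset; ∣_∣) renaming (_∈_ to _∈ˢ_)
  open import Data.List using (List; []; _∷_; map)
  open import Data.List.Properties using (map-cong; length-map)
  open import Data.List.Membership.Propositional using (_∈_)
  open import Data.List.Membership.Propositional.Properties using (∈-map⁺; ∈-map⁻)
  open import Data.List.Relation.Unary.All as All using (All; []; _∷_)
  open import Data.List.Relation.Unary.All.Properties using (map⁺)
  open import Data.List.Relation.Unary.AllPairs using (AllPairs; []; _∷_)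
  open import Data.Product using (Σ; _×_; _,_)
  open import Relation.Binary.PropositionalEquality
  open import Relation.Binary.Definitions using (tri<; tri≈; tri>)
  open import Relation.Nullary using (contradiction)
  open import Function using (_∘_)
  open SubsetCardinality
  open Modular

  d : ℕ
  d = 2 + e

  n : ℕ
  n = nC d

  ≤-lit : ∀ a b {_ : T (a ≤ᵇ b)} → a ≤ b
  ≤-lit a b {a≤ᵇb} = ≤ᵇ⇒≤ a b a≤ᵇb

  +e-≤ : ∀ a b {_ : T (a ≤ᵇ b)} → a + e ≤ b + e
  +e-≤ a b {a≤ᵇb} = +-monoˡ-≤ e (≤ᵇ⇒≤ a b a≤ᵇb)

  ≤+e : ∀ a b {_ : T (a ≤ᵇ b)} → a ≤ b + e
  ≤+e a b {a≤ᵇb} = ≤-trans (≤ᵇ⇒≤ a b a≤ᵇb) (m≤m+n b e)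

  opaque
    L : ℕ → Fin n
    L = lab d

    toℕ-L : ∀ x → toℕ (L x) ≡ (x + (n ∸ 1)) % n
    toℕ-L x = Fin.toℕ-fromℕ< _

    L≗lab : ∀ x → L x ≡ lab d x
    L≗lab x = refl

  L-periodic : ∀ x → L (n + x) ≡ L x
  L-periodic x = Fin.toℕ-injective (begin
    toℕ (L (n + x))               ≡⟨ toℕ-L (n + x) ⟩
    (n + x + (n ∸ 1)) % n         ≡⟨ cong (_% n) (trans (+-assoc n x _) (+-comm n _)) ⟩
    (x + (n ∸ 1) + n) % n         ≡⟨ [m+n]%n≡m%n (x + (n ∸ 1)) n ⟩
    (x + (n ∸ 1)) % n             ≡⟨ sym (toℕ-L x) ⟩
    toℕ (L x)                     ∎)
    where open ≡-Reasoning

  L-injective-window : ∀ {x y} → x < y → y < x + n → L x ≢ L y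
  L-injective-window {x} {y} x<y y<x+n Lx≡Ly = <⇒≢ x<y (+-cancelʳ-≡ (n ∸ 1) x y shifted≡)
    where
    shifted≡ : x + (n ∸ 1) ≡ y + (n ∸ 1)
    shifted≡ = m%n≡o%n∧m≤o<m+n⇒m≡o _ _ n
      (trans (sym (toℕ-L x)) (trans (cong toℕ Lx≡Ly) (toℕ-L y)))
      (+-monoˡ-≤ (n ∸ 1) (<⇒≤ x<y))
      (subst (y + (n ∸ 1) <_) (trans (+-assoc x n _) (trans (cong (x +_) (+-comm n _)) (sym (+-assoc x _ n))))
        (+-monoˡ-< (n ∸ 1) y<x+n))

  L-injective-window′ : ∀ {x y} → x ≢ y → x < y + n → y < x + n → L x ≢ L y
  L-injective-window′ {x} {y} x≢y x<y+n y<x+n with <-cmp x y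
  ... | tri< x<y _ _ = L-injective-window x<y y<x+n
  ... | tri≈ _ x≡y _ = contradiction x≡y x≢y
  ... | tri> _ _ y<x = L-injective-window y<x x<y+n ∘ sym

  L-injective-consecutive : ∀ x → L x ≢ L (suc x)
  L-injective-consecutive x = L-injective-window ≤-refl (subst (_≤ x + n) (+-comm x 2) (+-monoʳ-≤ x (≤+e 2 14)))

  L-injective-13 : ∀ {x y} → x < y → y ≤ x + 13 → L x ≢ L y
  L-injective-13 {x} x<y y≤x+13 =
    L-injective-window x<y (≤-trans (s≤s y≤x+13) (subst (_≤ x + n) (+-suc x 13) (+-monoʳ-≤ x (≤+e 14 14))))

  InWindow : ℕ → ℕ → Set
  InWindow lo y = lo ≤ y × y < lo + n

  opaque
    faceOf : List ℕ → Subset n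
    faceOf xs = setOf (map L xs)

    faceOf≡face : ∀ xs → faceOf xs ≡ face d xs
    faceOf≡face xs = cong setOf (map-cong L≗lab xs)

    ∈faceOf⁺ : ∀ {x xs} → x ∈ xs → L x ∈ˢ faceOf xs
    ∈faceOf⁺ x∈ = ∈setOf⁺ (∈-map⁺ L x∈)

    ∈faceOf⁻ : ∀ {z xs} → z ∈ˢ faceOf xs → Σ ℕ λ x → x ∈ xs × z ≡ L x
    ∈faceOf⁻ z∈ = ∈-map⁻ L (∈setOf⁻ z∈)

    ∣faceOf∣≡length : ∀ {lo xs} → AllPairs _<_ xs → All (InWindow lo) xs → ∣ faceOf xs ∣ ≡ length xs
    ∣faceOf∣≡length {xs = xs} sorted inWindow =
      trans (∣setOf∣≡length (map L xs) (unique sorted inWindow)) (length-map L xs)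
      where
      unique : ∀ {lo xs} → AllPairs _<_ xs → All (InWindow lo) xs → AllPairs _≢_ (map L xs)
      unique [] [] = []
      unique (x<xs ∷ sorted) ((lo≤x , _) ∷ inWindow) =
        map⁺ (All.zipWith (λ (x<y , _ , y<lo+n) → L-injective-window x<y (<-≤-trans y<lo+n (+-monoˡ-≤ n lo≤x)))
                          (x<xs , inWindow))
        ∷ unique sorted inWindow

module Facets (e : ℕ) where

  open import Data.Nat using (suc; _+_; _∸_; _<_; z≤n; s≤s)
  open import Data.Nat.Properties
  open import Data.Fin using (toℕ)
  open import Data.Fin.Subset using (Subset; ∣_∣; ⊥)
  open import Data.List using (List; []; _∷_; map; upTo; applyUpTo; _++_; lookup)
  open import Data.List.Properties using (map-upTo; length-++; length-map; length-upTo)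
  open import Data.List.Membership.Propositional using (_∈_)
  open import Data.List.Membership.Propositional.Properties using (∈-++⁻)
  open import Data.List.Relation.Unary.Any using (here; there)
  open import Data.List.Relation.Unary.All as All using (All; []; _∷_)
  open import Data.List.Relation.Unary.AllPairs using (AllPairs; []; _∷_)
  open import Data.List.Relation.Unary.AllPairs.Properties using (++⁺)
  open import Data.Product using (_×_; _,_; proj₁; proj₂; map₂)
  open import Data.Sum using (_⊎_; inj₁; inj₂)
  open import Relation.Binary.PropositionalEquality
  open import Function using (_∘_)
  open ListIndexing
  open Intervals
  open Labels e public

  H-labels : ℕ → List ℕ
  H-labels j = interval (suc j) (suc d)

  F₁-labels F₂-labels F₃-labels F₄-labels : List ℕ
  F₁-labels = 1 ∷ 5 ∷ interval 7 (suc e)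
  F₂-labels = 1 ∷ interval 7 (suc e) ++ (d + 7) ∷ []
  F₃-labels = 2 ∷ 8 ∷ interval 10 (suc e)
  F₄-labels = 2 ∷ interval 10 (suc e) ++ (d + 10) ∷ []

  H≡faceOf : ∀ j → H d (suc j) ≡ faceOf (H-labels j)
  H≡faceOf j = trans (cong (face d) (map-upTo≡interval (suc j) (suc d))) (sym (faceOf≡face (H-labels j)))

  private
    range-7 : range d 7 (d + 5) ≡ interval 7 (suc e)
    range-7 = trans (cong (λ c → map (7 +_) (upTo c)) (trans (cong (_∸ 4) (+-suc e 4)) (m+n∸n≡m (suc e) 4)))
                    (map-upTo≡interval 7 (suc e))

    range-10 : range d 10 (d + 8) ≡ interval 10 (suc e)
    range-10 = trans (cong (λ c → map (10 +_) (upTo c)) (trans (cong (_∸ 7) (+-suc e 7)) (m+n∸n≡m (suc e) 7)))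
                     (map-upTo≡interval 10 (suc e))

  F₁≡faceOf : F₁ d ≡ faceOf F₁-labels
  F₁≡faceOf = trans (cong (λ r → face d (1 ∷ 5 ∷ r)) range-7) (sym (faceOf≡face F₁-labels))

  F₂≡faceOf : F₂ d ≡ faceOf F₂-labels
  F₂≡faceOf = trans (cong (λ r → face d (1 ∷ r ++ (d + 7) ∷ [])) range-7) (sym (faceOf≡face F₂-labels))

  F₃≡faceOf : F₃ d ≡ faceOf F₃-labels
  F₃≡faceOf = trans (cong (λ r → face d (2 ∷ 8 ∷ r)) range-10) (sym (faceOf≡face F₃-labels))

  F₄≡faceOf : F₄ d ≡ faceOf F₄-labels
  F₄≡faceOf = trans (cong (λ r → face d (2 ∷ r ++ (d + 10) ∷ [])) range-10) (sym (faceOf≡face F₄-labels))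

  private
    Hs Fs : List (Subset n)
    Hs = map (λ k → H d (suc k)) (upTo n)
    Fs = F₁ d ∷ F₂ d ∷ F₃ d ∷ F₄ d ∷ []

    length-Hs : length Hs ≡ n
    length-Hs = trans (length-map _ (upTo n)) (length-upTo n)

  length-facetsC : length (facetsC d) ≡ n + 4
  length-facetsC = trans (length-++ Hs) (cong (_+ 4) length-Hs)

  -- facet j is entry j of facetsC: H_{j+1} for j < n and F_{j-n+1} beyond
  opaque
    facet : ℕ → Subset n
    facet j = nth (facetsC d) j ⊥

    lookup≡facet : ∀ a → lookup (facetsC d) a ≡ facet (toℕ a)
    lookup≡facet a = lookup≡nth (facetsC d) a ⊥

    facet≡H : ∀ {j} → j < n → facet j ≡ H d (suc j)
    facet≡H {j} j<n = begin
      nth (Hs ++ Fs) j ⊥                                     ≡⟨ nth-++ˡ Hs Fs j ⊥ (subst (j <_) (sym length-Hs) j<n) ⟩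
      nth Hs j ⊥                                             ≡⟨ cong (λ xs → nth xs j ⊥) (map-upTo (λ k → H d (suc k)) n) ⟩
      nth (applyUpTo (λ k → H d (suc k)) n) j ⊥    ≡⟨ nth-applyUpTo (λ k → H d (suc k)) n j ⊥ j<n ⟩
      H d (suc j)                                            ∎
      where open ≡-Reasoning

    facet-n+ : ∀ c → facet (n + c) ≡ nth Fs c ⊥
    facet-n+ c = trans (cong (λ z → nth (Hs ++ Fs) (z + c) ⊥) (sym length-Hs)) (nth-++ʳ Hs Fs c ⊥)

  facet≡H-labels : ∀ {j} → j < n → facet j ≡ faceOf (H-labels j)
  facet≡H-labels {j} j<n = trans (facet≡H j<n) (H≡faceOf j)

  facet-F₁ : facet (n + 0) ≡ faceOf F₁-labels
  facet-F₁ = trans (facet-n+ 0) F₁≡faceOf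

  facet-F₂ : facet (n + 1) ≡ faceOf F₂-labels
  facet-F₂ = trans (facet-n+ 1) F₂≡faceOf

  facet-F₃ : facet (n + 2) ≡ faceOf F₃-labels
  facet-F₃ = trans (facet-n+ 2) F₃≡faceOf

  facet-F₄ : facet (n + 3) ≡ faceOf F₄-labels
  facet-F₄ = trans (facet-n+ 3) F₄≡faceOf

  d+7≡9+e : d + 7 ≡ 9 + e
  d+7≡9+e = cong (suc ∘ suc) (+-comm e 7)

  d+10≡12+e : d + 10 ≡ 12 + e
  d+10≡12+e = cong (suc ∘ suc) (+-comm e 10)

  ∈F₁-labels⁻ : ∀ {y} → y ∈ F₁-labels → y ≡ 1 ⊎ y ≡ 5 ⊎ (7 ≤ y × y ≤ 7 + e)
  ∈F₁-labels⁻ (here refl)         = inj₁ refl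
  ∈F₁-labels⁻ (there (here refl)) = inj₂ (inj₁ refl)
  ∈F₁-labels⁻ (there (there y∈))  = inj₂ (inj₂ (map₂ ≤-pred (∈-interval⁻ y∈)))

  ∈F₂-labels⁻ : ∀ {y} → y ∈ F₂-labels → y ≡ 1 ⊎ (7 ≤ y × y ≤ 7 + e) ⊎ y ≡ 9 + e
  ∈F₂-labels⁻ (here refl) = inj₁ refl
  ∈F₂-labels⁻ (there y∈) with ∈-++⁻ (interval 7 (suc e)) y∈
  ... | inj₁ y∈interval = inj₂ (inj₁ (map₂ ≤-pred (∈-interval⁻ y∈interval)))
  ... | inj₂ (here refl) = inj₂ (inj₂ d+7≡9+e)

  ∈F₃-labels⁻ : ∀ {y} → y ∈ F₃-labels → y ≡ 2 ⊎ y ≡ 8 ⊎ (10 ≤ y × y ≤ 10 + e)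
  ∈F₃-labels⁻ (here refl)         = inj₁ refl
  ∈F₃-labels⁻ (there (here refl)) = inj₂ (inj₁ refl)
  ∈F₃-labels⁻ (there (there y∈))  = inj₂ (inj₂ (map₂ ≤-pred (∈-interval⁻ y∈)))

  ∈F₄-labels⁻ : ∀ {y} → y ∈ F₄-labels → y ≡ 2 ⊎ (10 ≤ y × y ≤ 10 + e) ⊎ y ≡ 12 + e
  ∈F₄-labels⁻ (here refl) = inj₁ refl
  ∈F₄-labels⁻ (there y∈) with ∈-++⁻ (interval 10 (suc e)) y∈
  ... | inj₁ y∈interval = inj₂ (inj₁ (map₂ ≤-pred (∈-interval⁻ y∈interval)))
  ... | inj₂ (here refl) = inj₂ (inj₂ d+10≡12+e)

  Labelled : List ℕ → Set
  Labelled xs = ∀ {y} → y ∈ xs → 1 ≤ y × y ≤ n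

  F₁-labelled : Labelled F₁-labels
  F₁-labelled y∈ with ∈F₁-labels⁻ y∈
  ... | inj₁ refl               = ≤-lit 1 1 , ≤+e 1 14
  ... | inj₂ (inj₁ refl)        = ≤-lit 1 5 , ≤+e 5 14
  ... | inj₂ (inj₂ (7≤y , y≤)) = ≤-trans (≤-lit 1 7) 7≤y , ≤-trans y≤ (+e-≤ 7 14)

  F₂-labelled : Labelled F₂-labels
  F₂-labelled y∈ with ∈F₂-labels⁻ y∈
  ... | inj₁ refl               = ≤-lit 1 1 , ≤+e 1 14
  ... | inj₂ (inj₁ (7≤y , y≤)) = ≤-trans (≤-lit 1 7) 7≤y , ≤-trans y≤ (+e-≤ 7 14)
  ... | inj₂ (inj₂ refl)        = s≤s z≤n , +e-≤ 9 14

  F₃-labelled : Labelled F₃-labels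
  F₃-labelled y∈ with ∈F₃-labels⁻ y∈
  ... | inj₁ refl                = ≤-lit 1 2 , ≤+e 2 14
  ... | inj₂ (inj₁ refl)         = ≤-lit 1 8 , ≤+e 8 14
  ... | inj₂ (inj₂ (10≤y , y≤)) = ≤-trans (≤-lit 1 10) 10≤y , ≤-trans y≤ (+e-≤ 10 14)

  F₄-labelled : Labelled F₄-labels
  F₄-labelled y∈ with ∈F₄-labels⁻ y∈
  ... | inj₁ refl                = ≤-lit 1 2 , ≤+e 2 14
  ... | inj₂ (inj₁ (10≤y , y≤)) = ≤-trans (≤-lit 1 10) 10≤y , ≤-trans y≤ (+e-≤ 10 14)
  ... | inj₂ (inj₂ refl)         = s≤s z≤n , +e-≤ 12 14

  private
    ∣faceOf-labelled∣ : ∀ {xs} → AllPairs _<_ xs → Labelled xs → ∣ faceOf xs ∣ ≡ length xs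
    ∣faceOf-labelled∣ sorted labelled =
      ∣faceOf∣≡length {lo = 1} sorted (All.tabulate (λ y∈ → map₂ s≤s (labelled y∈)))

    all-above : ∀ {a x c} → a < x → All (a <_) (interval x c)
    all-above a<x = All.tabulate (λ y∈ → <-≤-trans a<x (proj₁ (∈-interval⁻ y∈)))

    interval-++-sorted : ∀ a z → a + suc e ≤ z → AllPairs _<_ (interval a (suc e) ++ z ∷ [])
    interval-++-sorted a z a+e<z = ++⁺ (interval-sorted a (suc e)) ([] ∷ [])
      (All.tabulate (λ y∈ → (<-≤-trans (proj₂ (∈-interval⁻ y∈)) a+e<z) ∷ []))

  ∣H∣ : ∀ j → ∣ faceOf (H-labels j) ∣ ≡ suc d
  ∣H∣ j = trans (∣faceOf∣≡length {lo = suc j} (interval-sorted (suc j) (suc d)) (All.tabulate inWindow))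
                (length-interval (suc j) (suc d))
    where
    inWindow : ∀ {y} → y ∈ H-labels j → InWindow (suc j) y
    inWindow y∈ with ∈-interval⁻ y∈
    ... | j<y , y< = j<y , <-≤-trans y< (+-monoʳ-≤ (suc j) (+e-≤ 3 14))

  ∣F₁∣ : ∣ faceOf F₁-labels ∣ ≡ suc d
  ∣F₁∣ = trans (∣faceOf-labelled∣ sorted F₁-labelled) (cong (suc ∘ suc) (length-interval 7 (suc e)))
    where
    sorted : AllPairs _<_ F₁-labels
    sorted = (≤-lit 2 5 ∷ all-above (≤-lit 2 7)) ∷ all-above (≤-lit 6 7) ∷ interval-sorted 7 (suc e)

  ∣F₃∣ : ∣ faceOf F₃-labels ∣ ≡ suc d
  ∣F₃∣ = trans (∣faceOf-labelled∣ sorted F₃-labelled) (cong (suc ∘ suc) (length-interval 10 (suc e)))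
    where
    sorted : AllPairs _<_ F₃-labels
    sorted = (≤-lit 3 8 ∷ all-above (≤-lit 3 10)) ∷ all-above (≤-lit 9 10) ∷ interval-sorted 10 (suc e)

  private
    length-interval-++ : ∀ a z → length (interval a (suc e) ++ z ∷ []) ≡ suc (suc e)
    length-interval-++ a z = trans (length-++ (interval a (suc e))) (trans (cong (_+ 1) (length-interval a (suc e))) (+-comm (suc e) 1))

  ∣F₂∣ : ∣ faceOf F₂-labels ∣ ≡ suc d
  ∣F₂∣ = trans (∣faceOf-labelled∣ sorted F₂-labelled) (cong suc (length-interval-++ 7 (d + 7)))
    where
    sorted : AllPairs _<_ F₂-labels
    sorted = All.tabulate (λ y∈ → above (∈-++⁻ (interval 7 (suc e)) y∈))
           ∷ interval-++-sorted 7 (d + 7) (subst (8 + e ≤_) (sym d+7≡9+e) (+e-≤ 8 9))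
      where
      above : ∀ {y} → y ∈ interval 7 (suc e) ⊎ y ∈ (d + 7) ∷ [] → 1 < y
      above (inj₁ y∈) = <-≤-trans (≤-lit 2 7) (proj₁ (∈-interval⁻ y∈))
      above (inj₂ (here refl)) = ≤-trans (≤-lit 2 7) (m≤n+m 7 d)

  ∣F₄∣ : ∣ faceOf F₄-labels ∣ ≡ suc d
  ∣F₄∣ = trans (∣faceOf-labelled∣ sorted F₄-labelled) (cong suc (length-interval-++ 10 (d + 10)))
    where
    sorted : AllPairs _<_ F₄-labels
    sorted = All.tabulate (λ y∈ → above (∈-++⁻ (interval 10 (suc e)) y∈))
           ∷ interval-++-sorted 10 (d + 10) (subst (11 + e ≤_) (sym d+10≡12+e) (+e-≤ 11 12))
      where
      above : ∀ {y} → y ∈ interval 10 (suc e) ⊎ y ∈ (d + 10) ∷ [] → 2 < y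
      above (inj₁ y∈) = <-≤-trans (≤-lit 3 10) (proj₁ (∈-interval⁻ y∈))
      above (inj₂ (here refl)) = ≤-trans (≤-lit 3 10) (m≤n+m 10 d)

module Adjacency (e : ℕ) where

  open import Data.Nat using (suc; _+_; _<_; z≤n; s≤s)
  open import Data.Nat.Properties
  open import Data.Fin.Subset using (Subset; _∩_; ∣_∣) renaming (_∈_ to _∈ˢ_; _∉_ to _∉ˢ_)
  open import Data.Fin.Subset.Properties using (∩-comm; ∩-idem)
  open import Data.List using (List)
  open import Data.List.Membership.Propositional using (_∈_)
  open import Data.List.Membership.Propositional.Properties using (∈-++⁻; ∈-++⁺ˡ)
  open import Data.List.Relation.Unary.Any using (here; there)
  open import Data.Product using (Σ; _×_; _,_)
  open import Data.Sum using (_⊎_; inj₁; inj₂)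
  open import Relation.Nullary using (¬_; contradiction)
  open import Relation.Binary.PropositionalEquality
  open import Function using (_∘_)
  open SubsetCardinality
  open Intervals
  open Facets e public

  Adjacent : Subset n → Subset n → Set
  Adjacent A B = ∣ A ∩ B ∣ ≡ d

  Adjacent-sym : ∀ {A B} → Adjacent A B → Adjacent B A
  Adjacent-sym {A} {B} A~B = trans (cong ∣_∣ (∩-comm B A)) A~B

  ¬Adjacent-self : ∀ {A} → ∣ A ∣ ≡ suc d → ¬ Adjacent A A
  ¬Adjacent-self {A} ∣A∣≡ A~A = 1+n≰n (≤-reflexive (trans (sym ∣A∣≡) (trans (cong ∣_∣ (sym (∩-idem A))) A~A)))

  Outside : ℕ → List ℕ → Set
  Outside x ys = ∀ {y} → y ∈ ys → L x ≢ L y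

  ∉faceOf : ∀ {x ys} → Outside x ys → L x ∉ˢ faceOf ys
  ∉faceOf x∉ys Lx∈ with ∈faceOf⁻ Lx∈
  ... | y , y∈ , Lx≡Ly = x∉ys y∈ Lx≡Ly

  adjacent : ∀ {xs ys x} → ∣ faceOf xs ∣ ≡ suc d → x ∈ xs → Outside x ys →
             (∀ {a} → a ∈ xs → a ≡ x ⊎ L a ∈ˢ faceOf ys) → Adjacent (faceOf xs) (faceOf ys)
  adjacent {xs} {ys} {x} ∣xs∣≡ x∈ x∉ys rest =
    suc-injective (trans (1+∣p∩q∣≡∣p∣ (∈faceOf⁺ x∈) (∉faceOf x∉ys) rest′) ∣xs∣≡)
    where
    rest′ : ∀ z → z ∈ˢ faceOf xs → z ≢ L x → z ∈ˢ faceOf ys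
    rest′ z z∈ z≢Lx with ∈faceOf⁻ z∈
    ... | a , a∈ , refl with rest a∈
    ...   | inj₁ refl   = contradiction refl z≢Lx
    ...   | inj₂ La∈ys = La∈ys

  nonadjacent : ∀ {xs ys a b} → ∣ faceOf xs ∣ ≡ suc d → a ∈ xs → b ∈ xs → L a ≢ L b →
                Outside a ys → Outside b ys → ¬ Adjacent (faceOf xs) (faceOf ys)
  nonadjacent {xs} {ys} ∣xs∣≡ a∈ b∈ La≢Lb a∉ys b∉ys xs~ys = 1+n≰n (begin
    suc (suc d)                      ≡⟨ +-comm 2 d ⟩
    d + 2                            ≡⟨ cong (_+ 2) (sym xs~ys) ⟩
    ∣ faceOf xs ∩ faceOf ys ∣ + 2    ≤⟨ ∣p∩q∣+2≤∣p∣ La≢Lb (∈faceOf⁺ a∈) (∈faceOf⁺ b∈) (∉faceOf a∉ys) (∉faceOf b∉ys) ⟩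
    ∣ faceOf xs ∣                    ≡⟨ ∣xs∣≡ ⟩
    suc d                            ∎)
    where open ≤-Reasoning

  nonadjacentʳ : ∀ {xs ys a b} → ∣ faceOf ys ∣ ≡ suc d → a ∈ ys → b ∈ ys → L a ≢ L b →
                 Outside a xs → Outside b xs → ¬ Adjacent (faceOf xs) (faceOf ys)
  nonadjacentʳ {xs} {ys} ∣ys∣≡ a∈ b∈ La≢Lb a∉xs b∉xs =
    nonadjacent ∣ys∣≡ a∈ b∈ La≢Lb a∉xs b∉xs ∘ Adjacent-sym {faceOf xs} {faceOf ys}

  outside-labelled : ∀ {x ys} → 1 ≤ x → x ≤ n → Labelled ys → (∀ {y} → y ∈ ys → x ≢ y) → Outside x ys
  outside-labelled {x} 1≤x x≤n labelled x≢ {y} y∈ with labelled y∈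
  ... | 1≤y , y≤n = L-injective-window′ (x≢ y∈) (<-≤-trans (s≤s x≤n) (shift 1≤y)) (<-≤-trans (s≤s y≤n) (shift 1≤x))
    where
    shift : ∀ {z} → 1 ≤ z → suc n ≤ z + n
    shift {z} 1≤z = subst (suc n ≤_) (+-comm n z) (subst (_≤ n + z) (+-comm n 1) (+-monoʳ-≤ n 1≤z))

  outside-below : ∀ {x a c} → x < a → a + c ≤ x + n → Outside x (interval a c)
  outside-below x<a a+c≤x+n y∈ with ∈-interval⁻ y∈
  ... | a≤y , y< = L-injective-window (<-≤-trans x<a a≤y) (<-≤-trans y< a+c≤x+n)

  outside-above : ∀ {x a c} → a + c ≤ x → x < a + n → Outside x (interval a c)
  outside-above {a = a} a+c≤x x<a+n y∈ with ∈-interval⁻ y∈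
  ... | a≤y , y< = L-injective-window (<-≤-trans y< a+c≤x) (<-≤-trans x<a+n (+-monoˡ-≤ n a≤y)) ∘ sym

  AdjacentFacets : ℕ → ℕ → Set
  AdjacentFacets j k = Adjacent (facet j) (facet k)

  AdjacentFacets-sym : ∀ {j k} → AdjacentFacets j k → AdjacentFacets k j
  AdjacentFacets-sym {j} {k} = Adjacent-sym {facet j} {facet k}

  H-adjacent-next : ∀ {k} → suc k < n → AdjacentFacets k (suc k)
  H-adjacent-next {k} k+1<n = subst₂ Adjacent (sym (facet≡H-labels (<-trans (n<1+n k) k+1<n))) (sym (facet≡H-labels k+1<n))
    (adjacent (∣H∣ k) (here refl)
      (outside-below (n<1+n (suc k)) (≤-trans (≤-reflexive (sym (+-suc (suc k) (suc d)))) (+-monoʳ-≤ (suc k) (+e-≤ 4 14))))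
      rest)
    where
    rest : ∀ {a} → a ∈ H-labels k → a ≡ suc k ⊎ L a ∈ˢ faceOf (H-labels (suc k))
    rest (here refl) = inj₁ refl
    rest (there a∈)  = inj₂ (∈faceOf⁺ (interval-mono (n≤1+n _) a∈))

  H-adjacent-wrap : AdjacentFacets (13 + e) 0
  H-adjacent-wrap = subst₂ Adjacent (sym (facet≡H-labels ≤-refl)) (sym (facet≡H-labels (s≤s z≤n)))
    (adjacent (∣H∣ (13 + e)) (here refl) (outside-above (+e-≤ 4 14) ≤-refl) rest)
    where
    rest : ∀ {a} → a ∈ H-labels (13 + e) → a ≡ n ⊎ L a ∈ˢ faceOf (H-labels 0)
    rest (here refl) = inj₁ refl
    rest {a} (there a∈) = inj₂ (shifted (∈-interval-shift⁻ {k = n} {a = 1} (subst (λ b → a ∈ interval b d) (+-comm 1 n) a∈)))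
      where
      shifted : Σ ℕ (λ t → a ≡ n + t × t ∈ interval 1 d) → L a ∈ˢ faceOf (H-labels 0)
      shifted (t , a≡n+t , t∈) = subst (_∈ˢ faceOf (H-labels 0)) (trans (sym (L-periodic t)) (cong L (sym a≡n+t)))
                                       (∈faceOf⁺ (interval-mono (n≤1+n d) t∈))

  private
    ≢-outside-interval : ∀ {x y a b} → x < a ⊎ b < x → a ≤ y × y ≤ b → x ≢ y
    ≢-outside-interval (inj₁ x<a) (a≤y , _) = <⇒≢ (<-≤-trans x<a a≤y)
    ≢-outside-interval (inj₂ b<x) (_ , y≤b) = >⇒≢ (≤-<-trans y≤b b<x)

  outside-F₁ : ∀ {x} → 1 ≤ x → x ≤ n → x ≢ 1 → x ≢ 5 → x < 7 ⊎ 7 + e < x → Outside x F₁-labels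
  outside-F₁ {x} 1≤x x≤n x≢1 x≢5 x∉7… = outside-labelled 1≤x x≤n F₁-labelled (x≢ ∘ ∈F₁-labels⁻)
    where
    x≢ : ∀ {y} → y ≡ 1 ⊎ y ≡ 5 ⊎ (7 ≤ y × y ≤ 7 + e) → x ≢ y
    x≢ (inj₁ refl)          = x≢1
    x≢ (inj₂ (inj₁ refl))   = x≢5
    x≢ (inj₂ (inj₂ y∈7…)) = ≢-outside-interval x∉7… y∈7…

  outside-F₂ : ∀ {x} → 1 ≤ x → x ≤ n → x ≢ 1 → x < 7 ⊎ 7 + e < x → x ≢ 9 + e → Outside x F₂-labels
  outside-F₂ {x} 1≤x x≤n x≢1 x∉7… x≢9+e = outside-labelled 1≤x x≤n F₂-labelled (x≢ ∘ ∈F₂-labels⁻)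
    where
    x≢ : ∀ {y} → y ≡ 1 ⊎ (7 ≤ y × y ≤ 7 + e) ⊎ y ≡ 9 + e → x ≢ y
    x≢ (inj₁ refl)          = x≢1
    x≢ (inj₂ (inj₁ y∈7…)) = ≢-outside-interval x∉7… y∈7…
    x≢ (inj₂ (inj₂ refl))   = x≢9+e

  outside-F₃ : ∀ {x} → 1 ≤ x → x ≤ n → x ≢ 2 → x ≢ 8 → x < 10 ⊎ 10 + e < x → Outside x F₃-labels
  outside-F₃ {x} 1≤x x≤n x≢2 x≢8 x∉10… = outside-labelled 1≤x x≤n F₃-labelled (x≢ ∘ ∈F₃-labels⁻)
    where
    x≢ : ∀ {y} → y ≡ 2 ⊎ y ≡ 8 ⊎ (10 ≤ y × y ≤ 10 + e) → x ≢ y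
    x≢ (inj₁ refl)           = x≢2
    x≢ (inj₂ (inj₁ refl))    = x≢8
    x≢ (inj₂ (inj₂ y∈10…)) = ≢-outside-interval x∉10… y∈10…

  outside-F₄ : ∀ {x} → 1 ≤ x → x ≤ n → x ≢ 2 → x < 10 ⊎ 10 + e < x → x ≢ 12 + e → Outside x F₄-labels
  outside-F₄ {x} 1≤x x≤n x≢2 x∉10… x≢12+e = outside-labelled 1≤x x≤n F₄-labelled (x≢ ∘ ∈F₄-labels⁻)
    where
    x≢ : ∀ {y} → y ≡ 2 ⊎ (10 ≤ y × y ≤ 10 + e) ⊎ y ≡ 12 + e → x ≢ y
    x≢ (inj₁ refl)           = x≢2
    x≢ (inj₂ (inj₁ y∈10…)) = ≢-outside-interval x∉10… y∈10…
    x≢ (inj₂ (inj₂ refl))    = x≢12+e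

  F₁-adjacent-F₂ : AdjacentFacets (n + 0) (n + 1)
  F₁-adjacent-F₂ = subst₂ Adjacent (sym facet-F₁) (sym facet-F₂)
    (adjacent ∣F₁∣ (there (here refl)) (outside-F₂ (≤-lit 1 5) (≤+e 5 14) (λ ()) (inj₁ (≤-lit 6 7)) (λ ())) rest)
    where
    rest : ∀ {a} → a ∈ F₁-labels → a ≡ 5 ⊎ L a ∈ˢ faceOf F₂-labels
    rest (here refl)         = inj₂ (∈faceOf⁺ (here refl))
    rest (there (here refl)) = inj₁ refl
    rest (there (there a∈))  = inj₂ (∈faceOf⁺ (there (∈-++⁺ˡ a∈)))

  F₃-adjacent-F₄ : AdjacentFacets (n + 2) (n + 3)
  F₃-adjacent-F₄ = subst₂ Adjacent (sym facet-F₃) (sym facet-F₄)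
    (adjacent ∣F₃∣ (there (here refl)) (outside-F₄ (≤-lit 1 8) (≤+e 8 14) (λ ()) (inj₁ (≤-lit 9 10)) (λ ())) rest)
    where
    rest : ∀ {a} → a ∈ F₃-labels → a ≡ 8 ⊎ L a ∈ˢ faceOf F₄-labels
    rest (here refl)         = inj₂ (∈faceOf⁺ (here refl))
    rest (there (here refl)) = inj₁ refl
    rest (there (there a∈))  = inj₂ (∈faceOf⁺ (there (∈-++⁺ˡ a∈)))

  F₁-adjacent-H₅ : AdjacentFacets (n + 0) 4
  F₁-adjacent-H₅ = subst₂ Adjacent (sym facet-F₁) (sym (facet≡H-labels (≤+e 5 14)))
    (adjacent ∣F₁∣ (here refl) (outside-below (≤-lit 2 5) (+e-≤ 8 15)) rest)
    where
    rest : ∀ {a} → a ∈ F₁-labels → a ≡ 1 ⊎ L a ∈ˢ faceOf (H-labels 4)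
    rest (here refl)         = inj₁ refl
    rest (there (here refl)) = inj₂ (∈faceOf⁺ (∈-interval⁺ ≤-refl (≤+e 6 8)))
    rest (there (there a∈)) with ∈-interval⁻ a∈
    ... | 7≤a , a< = inj₂ (∈faceOf⁺ (∈-interval⁺ (≤-trans (≤-lit 5 7) 7≤a) a<))

  F₃-adjacent-H₈ : AdjacentFacets (n + 2) 7
  F₃-adjacent-H₈ = subst₂ Adjacent (sym facet-F₃) (sym (facet≡H-labels (≤+e 8 14)))
    (adjacent ∣F₃∣ (here refl) (outside-below (≤-lit 3 8) (+e-≤ 11 16)) rest)
    where
    rest : ∀ {a} → a ∈ F₃-labels → a ≡ 2 ⊎ L a ∈ˢ faceOf (H-labels 7)
    rest (here refl)         = inj₁ refl
    rest (there (here refl)) = inj₂ (∈faceOf⁺ (∈-interval⁺ ≤-refl (≤+e 9 11)))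
    rest (there (there a∈)) with ∈-interval⁻ a∈
    ... | 10≤a , a< = inj₂ (∈faceOf⁺ (∈-interval⁺ (≤-trans (≤-lit 8 10) 10≤a) (≤-trans a< (+e-≤ 11 11))))

  F₂-adjacent-H₇ : AdjacentFacets (n + 1) 6
  F₂-adjacent-H₇ = subst₂ Adjacent (sym facet-F₂) (sym (facet≡H-labels (≤+e 7 14)))
    (adjacent ∣F₂∣ (here refl) (outside-below (≤-lit 2 7) (+e-≤ 10 15)) rest)
    where
    rest : ∀ {a} → a ∈ F₂-labels → a ≡ 1 ⊎ L a ∈ˢ faceOf (H-labels 6)
    rest (here refl) = inj₁ refl
    rest (there a∈) with ∈-++⁻ (interval 7 (suc e)) a∈
    ... | inj₁ a∈7… = inj₂ (∈faceOf⁺ (interval-mono (+e-≤ 1 3) a∈7…))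
    ... | inj₂ (here refl) = inj₂ (∈faceOf⁺ (∈-interval⁺ (≤-trans (≤+e 7 9) (≤-reflexive (sym d+7≡9+e)))
                                                          (subst (_< 10 + e) (sym d+7≡9+e) ≤-refl)))

  F₄-adjacent-H₁₀ : AdjacentFacets (n + 3) 9
  F₄-adjacent-H₁₀ = subst₂ Adjacent (sym facet-F₄) (sym (facet≡H-labels (≤+e 10 14)))
    (adjacent ∣F₄∣ (here refl) (outside-below (≤-lit 3 10) (+e-≤ 13 16)) rest)
    where
    rest : ∀ {a} → a ∈ F₄-labels → a ≡ 2 ⊎ L a ∈ˢ faceOf (H-labels 9)
    rest (here refl) = inj₁ refl
    rest (there a∈) with ∈-++⁻ (interval 10 (suc e)) a∈
    ... | inj₁ a∈10… = inj₂ (∈faceOf⁺ (interval-mono (+e-≤ 1 3) a∈10…))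
    ... | inj₂ (here refl) = inj₂ (∈faceOf⁺ (∈-interval⁺ (≤-trans (≤+e 10 12) (≤-reflexive (sym d+10≡12+e)))
                                                           (subst (_< 13 + e) (sym d+10≡12+e) ≤-refl)))

module Neighbourhoods (e : ℕ) where

  open import Data.Nat using (suc; _+_; _∸_; _<_; z≤n; s≤s; _≤?_; _<?_)
  open import Data.Nat.Properties
  open import Data.Fin.Subset using (∣_∣)
  open import Data.List using (List)
  open import Data.List.Membership.Propositional using (_∈_)
  open import Data.List.Relation.Unary.Any using (here; there)
  open import Data.Product using (Σ; _×_; _,_)
  open import Data.Sum using (_⊎_; inj₁; inj₂)
  open import Data.Empty using (⊥-elim)
  open import Relation.Nullary using (¬_; yes; no)
  open import Relation.Binary.PropositionalEquality
  open Intervals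
  open Adjacency e public

  nonadjacent-H : ∀ {i j xs a b} → facet i ≡ faceOf xs → j < n → a ∈ H-labels j → b ∈ H-labels j → L a ≢ L b →
                  Outside a xs → Outside b xs → ¬ AdjacentFacets i j
  nonadjacent-H {i} {j} {xs} facet-i j<n a∈ b∈ La≢Lb a∉xs b∉xs =
    subst₂ (λ A B → ¬ Adjacent A B) (sym facet-i) (sym (facet≡H-labels j<n))
      (nonadjacentʳ (∣H∣ j) a∈ b∈ La≢Lb a∉xs b∉xs)

  nonadjacent-F : ∀ {i xs ys a b} → facet i ≡ faceOf xs → ∣ faceOf xs ∣ ≡ suc d → ∀ {c} → facet (n + c) ≡ faceOf ys →
                  a ∈ xs → b ∈ xs → L a ≢ L b → Outside a ys → Outside b ys → ¬ AdjacentFacets i (n + c)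
  nonadjacent-F facet-i ∣xs∣≡ facet-c a∈ b∈ La≢Lb a∉ys b∉ys =
    subst₂ (λ A B → ¬ Adjacent A B) (sym facet-i) (sym facet-c) (nonadjacent ∣xs∣≡ a∈ b∈ La≢Lb a∉ys b∉ys)

  ¬AdjacentFacets-self : ∀ {i xs} → facet i ≡ faceOf xs → ∣ faceOf xs ∣ ≡ suc d → ¬ AdjacentFacets i i
  ¬AdjacentFacets-self {xs = xs} facet-i ∣xs∣≡ = subst (λ A → ¬ Adjacent A A) (sym facet-i) (¬Adjacent-self {faceOf xs} ∣xs∣≡)

  OutsideFrom : List ℕ → ℕ → Set
  OutsideFrom xs k = ∀ {x} → k ≤ x → x ≤ n → Outside x xs

  F₁-outside-from : OutsideFrom F₁-labels (8 + e)
  F₁-outside-from 8+e≤x x≤n =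
    outside-F₁ (≤-trans (s≤s z≤n) 8+e≤x) x≤n (>⇒≢ (≤-trans (≤+e 2 8) 8+e≤x)) (>⇒≢ (≤-trans (≤+e 6 8) 8+e≤x)) (inj₂ 8+e≤x)

  F₂-outside-from : OutsideFrom F₂-labels (10 + e)
  F₂-outside-from 10+e≤x x≤n =
    outside-F₂ (≤-trans (s≤s z≤n) 10+e≤x) x≤n (>⇒≢ (≤-trans (≤+e 2 10) 10+e≤x)) (inj₂ (≤-trans (+e-≤ 8 10) 10+e≤x)) (>⇒≢ 10+e≤x)

  -- A facet missing every label from k on is not adjacent to the H-facets containing two such labels.
  module _ {i xs k} (facet-i : facet i ≡ faceOf xs) (outside-from : OutsideFrom xs k) where

    nonadjacent-H-middle : ∀ {j} → k ≤ suc j + suc e → j ≤ 11 → ¬ AdjacentFacets i j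
    nonadjacent-H-middle {j} k≤ j≤11 =
      nonadjacent-H facet-i (≤-trans (s≤s j≤11) (≤+e 12 14)) (+-∈-interval (s≤s (n≤1+n _))) top∈
        (L-injective-consecutive (suc j + suc e)) (outside-from k≤ a≤n) (outside-from (≤-trans k≤ (n≤1+n _)) b≤n)
      where
      top∈ : suc (suc j + suc e) ∈ H-labels j
      top∈ = subst (_∈ H-labels j) (+-suc (suc j) (suc e)) (+-∈-interval ≤-refl)
      a≤n : suc j + suc e ≤ n
      a≤n = ≤-trans (+-monoˡ-≤ (suc e) (s≤s j≤11)) (+e-≤ 13 14)
      b≤n : suc (suc j + suc e) ≤ n
      b≤n = s≤s (+-monoˡ-≤ (suc e) (s≤s j≤11))

    nonadjacent-H-high : k ≤ 13 + e → ∀ {j} → 12 ≤ j → j ≤ 12 + e → ¬ AdjacentFacets i j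
    nonadjacent-H-high k≤ {j} 12≤j j≤ =
      nonadjacent-H facet-i (≤-trans (s≤s j≤) (+e-≤ 13 14)) (∈-interval⁺ (s≤s j≤) (≤-trans (+e-≤ 14 16) top))
        (∈-interval⁺ (≤-trans (s≤s j≤) (+e-≤ 13 14)) (≤-trans (+e-≤ 15 16) top))
        (L-injective-consecutive (13 + e)) (outside-from k≤ (+e-≤ 13 14)) (outside-from (≤-trans k≤ (+e-≤ 13 14)) ≤-refl)
      where
      top : 16 + e ≤ suc j + suc d
      top = +-monoˡ-≤ (suc d) (s≤s 12≤j)

    nonadjacent-H-last : k ≤ 14 + e → Outside 2 xs → ¬ AdjacentFacets i (13 + e)
    nonadjacent-H-last k≤ 2∉xs =
      nonadjacent-H facet-i ≤-refl (here refl) (there (there (here refl)))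
        (L-injective-13 (+e-≤ 15 16) (≤-trans (+e-≤ 16 27) (≤-reflexive (sym (+-comm (14 + e) 13)))))
        (outside-from k≤ ≤-refl) (λ y∈ L[n+2]≡Ly → 2∉xs y∈ (trans (sym L[n+2]≡L2) L[n+2]≡Ly))
      where
      L[n+2]≡L2 : L (16 + e) ≡ L 2
      L[n+2]≡L2 = trans (cong L (+-comm 2 n)) (L-periodic 2)

  private
    facet-H₆ : facet 5 ≡ faceOf (H-labels 5)
    facet-H₆ = facet≡H-labels (≤+e 6 14)

    H₆-outside-below : ∀ {x} → x < 6 → Outside x (H-labels 5)
    H₆-outside-below {x} x<6 = outside-below x<6 (≤-trans (+e-≤ 9 14) (m≤n+m n x))

    F₁-outside-small : ∀ {x} → 2 ≤ x → x < 7 → x ≢ 5 → Outside x F₁-labels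
    F₁-outside-small 2≤x x<7 x≢5 = outside-F₁ (≤-trans (s≤s z≤n) 2≤x) (≤-trans (<⇒≤ x<7) (≤+e 7 14)) (>⇒≢ 2≤x) x≢5 (inj₁ x<7)

    F₂-outside-small : ∀ {x} → 2 ≤ x → x < 7 → Outside x F₂-labels
    F₂-outside-small 2≤x x<7 = outside-F₂ (≤-trans (s≤s z≤n) 2≤x) (≤-trans (<⇒≤ x<7) (≤+e 7 14)) (>⇒≢ 2≤x) (inj₁ x<7) (<⇒≢ (<-≤-trans x<7 (≤+e 7 9)))

    6≢8+e : L 6 ≢ L (8 + e)
    6≢8+e = L-injective-window (≤+e 7 8) (+e-≤ 9 20)

    8+e∈H₆ : 8 + e ∈ H-labels 5
    8+e∈H₆ = ∈-interval⁺ (≤+e 6 8) ≤-refl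

    8+e∉F₂ : Outside (8 + e) F₂-labels
    8+e∉F₂ = outside-F₂ (s≤s z≤n) (+e-≤ 8 14) (λ ()) (inj₂ ≤-refl) (<⇒≢ (+e-≤ 9 9))

    H₆-nonadjacent-below : ∀ {j} → suc (suc j) < 6 → ¬ AdjacentFacets 5 j
    H₆-nonadjacent-below {j} j+2<6 =
      nonadjacent-H facet-H₆ (<-trans (<-trans (n<1+n j) (n<1+n _)) (<-≤-trans j+2<6 (≤+e 6 14)))
        (here refl) (there (here refl)) (L-injective-consecutive (suc j))
        (H₆-outside-below (<-trans (n<1+n _) j+2<6)) (H₆-outside-below j+2<6)

    H₆-nonadjacent-middle : ∀ {r} → r ≤ suc e → ¬ AdjacentFacets 5 (7 + r)
    H₆-nonadjacent-middle {r} r≤ =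
      nonadjacent-H facet-H₆ (s≤s (+-monoʳ-≤ 7 (≤-trans r≤ (≤-trans (n≤1+n _) (m≤n+m (suc (suc e)) 4)))))
        (∈-interval⁺ (+-monoʳ-≤ 8 r≤) (≤-trans (+e-≤ 10 11) top)) (∈-interval⁺ (≤-trans (+-monoʳ-≤ 8 r≤) (+e-≤ 9 10)) top)
        (L-injective-consecutive (9 + e)) (outside-above ≤-refl (+e-≤ 10 20)) (outside-above (+e-≤ 9 10) (+e-≤ 11 20))
      where
      top : 11 + e ≤ 8 + r + suc d
      top = +-monoʳ-≤ 8 (m≤n+m (suc d) r)

    H₆-nonadjacent-high : ∀ {r} → 2 + e ≤ r → 7 + r < n → ¬ AdjacentFacets 5 (7 + r)
    H₆-nonadjacent-high {r} 2+e≤r 7+r<n =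
      nonadjacent-H facet-H₆ 7+r<n (here refl) (there (here refl)) (L-injective-consecutive (8 + r))
        (outside-above 9+e≤8+r (≤-trans (s≤s 7+r<n) (+e-≤ 15 20)))
        (outside-above (≤-trans 9+e≤8+r (n≤1+n _)) (≤-trans (s≤s (s≤s 7+r<n)) (+e-≤ 16 20)))
      where
      9+e≤8+r : 9 + e ≤ 8 + r
      9+e≤8+r = ≤-trans (+-monoʳ-≤ 7 2+e≤r) (n≤1+n _)

  H₆-neighbours-H : ∀ j → j < n → AdjacentFacets 5 j → j ≡ 4 ⊎ j ≡ 6
  H₆-neighbours-H 0 _ adj = ⊥-elim (H₆-nonadjacent-below (≤-lit 3 6) adj)
  H₆-neighbours-H 1 _ adj = ⊥-elim (H₆-nonadjacent-below (≤-lit 4 6) adj)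
  H₆-neighbours-H 2 _ adj = ⊥-elim (H₆-nonadjacent-below (≤-lit 5 6) adj)
  H₆-neighbours-H 3 _ adj = ⊥-elim (H₆-nonadjacent-below (≤-lit 6 6) adj)
  H₆-neighbours-H 4 _ adj = inj₁ refl
  H₆-neighbours-H 5 _ adj = ⊥-elim (¬AdjacentFacets-self facet-H₆ (∣H∣ 5) adj)
  H₆-neighbours-H 6 _ adj = inj₂ refl
  H₆-neighbours-H (suc (suc (suc (suc (suc (suc (suc r))))))) 7+r<n adj with r ≤? suc e
  ... | yes r≤ = ⊥-elim (H₆-nonadjacent-middle r≤ adj)
  ... | no  r≰ = ⊥-elim (H₆-nonadjacent-high (≰⇒> r≰) 7+r<n adj)

  H₆-nonadjacent-F : ∀ {c} → c < 4 → ¬ AdjacentFacets 5 (n + c)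
  H₆-nonadjacent-F {0} _ = nonadjacent-F facet-H₆ (∣H∣ 5) facet-F₁ (here refl) 8+e∈H₆ 6≢8+e
    (F₁-outside-small (≤-lit 2 6) ≤-refl (λ ())) (F₁-outside-from ≤-refl (+e-≤ 8 14))
  H₆-nonadjacent-F {1} _ = nonadjacent-F facet-H₆ (∣H∣ 5) facet-F₂ (here refl) 8+e∈H₆ 6≢8+e
    (F₂-outside-small (≤-lit 2 6) ≤-refl) 8+e∉F₂
  H₆-nonadjacent-F {2} _ = nonadjacent-F facet-H₆ (∣H∣ 5) facet-F₃ (here refl) (there (here refl))
    (L-injective-consecutive 6)
    (outside-F₃ (≤-lit 1 6) (≤+e 6 14) (λ ()) (λ ()) (inj₁ (≤-lit 7 10)))
    (outside-F₃ (≤-lit 1 7) (≤+e 7 14) (λ ()) (λ ()) (inj₁ (≤-lit 8 10)))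
  H₆-nonadjacent-F {3} _ = nonadjacent-F facet-H₆ (∣H∣ 5) facet-F₄ (here refl) (there (here refl))
    (L-injective-consecutive 6)
    (outside-F₄ (≤-lit 1 6) (≤+e 6 14) (λ ()) (inj₁ (≤-lit 7 10)) (λ ()))
    (outside-F₄ (≤-lit 1 7) (≤+e 7 14) (λ ()) (inj₁ (≤-lit 8 10)) (λ ()))
  H₆-nonadjacent-F {suc (suc (suc (suc c)))} (s≤s (s≤s (s≤s (s≤s ()))))

  F₁-neighbours-H : ∀ j → j < n → AdjacentFacets (n + 0) j → j ≡ 4
  F₁-neighbours-H 0 j<n adj = ⊥-elim (nonadjacent-H facet-F₁ j<n (there (here refl)) (there (there (here refl)))
    (L-injective-consecutive 2) (F₁-outside-small ≤-refl (≤-lit 3 7) (λ ())) (F₁-outside-small (≤-lit 2 3) (≤-lit 4 7) (λ ())) adj)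
  F₁-neighbours-H 1 j<n adj = ⊥-elim (nonadjacent-H facet-F₁ j<n (here refl) (there (here refl))
    (L-injective-consecutive 2) (F₁-outside-small ≤-refl (≤-lit 3 7) (λ ())) (F₁-outside-small (≤-lit 2 3) (≤-lit 4 7) (λ ())) adj)
  F₁-neighbours-H 2 j<n adj = ⊥-elim (nonadjacent-H facet-F₁ j<n (here refl) (there (here refl))
    (L-injective-consecutive 3) (F₁-outside-small (≤-lit 2 3) (≤-lit 4 7) (λ ())) (F₁-outside-small (≤-lit 2 4) (≤-lit 5 7) (λ ())) adj)
  F₁-neighbours-H 3 j<n adj = ⊥-elim (nonadjacent-H facet-F₁ j<n (here refl) (there (there (here refl)))
    (L-injective-13 (≤-lit 5 6) (≤-lit 6 17)) (F₁-outside-small (≤-lit 2 4) (≤-lit 5 7) (λ ())) (F₁-outside-small (≤-lit 2 6) (≤-lit 7 7) (λ ())) adj)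
  F₁-neighbours-H 4 j<n adj = refl
  F₁-neighbours-H 5 j<n adj = ⊥-elim (nonadjacent-H facet-F₁ j<n (here refl) 8+e∈H₆ 6≢8+e
    (F₁-outside-small (≤-lit 2 6) (≤-lit 7 7) (λ ())) (F₁-outside-from ≤-refl (+e-≤ 8 14)) adj)
  F₁-neighbours-H (suc (suc (suc (suc (suc (suc r)))))) j<n adj with 6 + r ≤? 11 | 6 + r ≤? 12 + e
  ... | yes j≤11 | _        = ⊥-elim (nonadjacent-H-middle facet-F₁ F₁-outside-from (+-monoʳ-≤ 7 (m≤n+m (suc e) r)) j≤11 adj)
  ... | no  j≰11 | yes j≤   = ⊥-elim (nonadjacent-H-high facet-F₁ F₁-outside-from (+e-≤ 8 13) (≰⇒> j≰11) j≤ adj)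
  ... | no  _    | no  j≰   = ⊥-elim (nonadjacent-H-last facet-F₁ F₁-outside-from (+e-≤ 8 14)
                                (F₁-outside-small ≤-refl (≤-lit 3 7) (λ ()))
                                (subst (AdjacentFacets (n + 0)) (≤-antisym (≤-pred j<n) (≰⇒> j≰)) adj))

  F₁-neighbours-F : ∀ c → c < 4 → AdjacentFacets (n + 0) (n + c) → c ≡ 1
  F₁-neighbours-F 0 _ adj = ⊥-elim (¬AdjacentFacets-self facet-F₁ ∣F₁∣ adj)
  F₁-neighbours-F 1 _ adj = refl
  F₁-neighbours-F 2 _ adj = ⊥-elim (nonadjacent-F facet-F₁ ∣F₁∣ facet-F₃ (here refl) (there (here refl))
    (L-injective-13 (≤-lit 2 5) (≤-lit 5 14))
    (outside-F₃ (≤-lit 1 1) (≤+e 1 14) (λ ()) (λ ()) (inj₁ (≤-lit 2 10)))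
    (outside-F₃ (≤-lit 1 5) (≤+e 5 14) (λ ()) (λ ()) (inj₁ (≤-lit 6 10))) adj)
  F₁-neighbours-F 3 _ adj = ⊥-elim (nonadjacent-F facet-F₁ ∣F₁∣ facet-F₄ (here refl) (there (here refl))
    (L-injective-13 (≤-lit 2 5) (≤-lit 5 14))
    (outside-F₄ (≤-lit 1 1) (≤+e 1 14) (λ ()) (inj₁ (≤-lit 2 10)) (λ ()))
    (outside-F₄ (≤-lit 1 5) (≤+e 5 14) (λ ()) (inj₁ (≤-lit 6 10)) (λ ())) adj)
  F₁-neighbours-F (suc (suc (suc (suc c)))) (s≤s (s≤s (s≤s (s≤s ())))) adj

  F₂-neighbours-H : ∀ j → j < n → AdjacentFacets (n + 1) j → j ≡ 6
  F₂-neighbours-H 0 j<n adj = ⊥-elim (nonadjacent-H facet-F₂ j<n (there (here refl)) (there (there (here refl)))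
    (L-injective-consecutive 2) (F₂-outside-small ≤-refl (≤-lit 3 7)) (F₂-outside-small (≤-lit 2 3) (≤-lit 4 7)) adj)
  F₂-neighbours-H 1 j<n adj = ⊥-elim (nonadjacent-H facet-F₂ j<n (here refl) (there (here refl))
    (L-injective-consecutive 2) (F₂-outside-small ≤-refl (≤-lit 3 7)) (F₂-outside-small (≤-lit 2 3) (≤-lit 4 7)) adj)
  F₂-neighbours-H 2 j<n adj = ⊥-elim (nonadjacent-H facet-F₂ j<n (here refl) (there (here refl))
    (L-injective-consecutive 3) (F₂-outside-small (≤-lit 2 3) (≤-lit 4 7)) (F₂-outside-small (≤-lit 2 4) (≤-lit 5 7)) adj)
  F₂-neighbours-H 3 j<n adj = ⊥-elim (nonadjacent-H facet-F₂ j<n (here refl) (there (here refl))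
    (L-injective-consecutive 4) (F₂-outside-small (≤-lit 2 4) (≤-lit 5 7)) (F₂-outside-small (≤-lit 2 5) (≤-lit 6 7)) adj)
  F₂-neighbours-H 4 j<n adj = ⊥-elim (nonadjacent-H facet-F₂ j<n (here refl) (there (here refl))
    (L-injective-consecutive 5) (F₂-outside-small (≤-lit 2 5) (≤-lit 6 7)) (F₂-outside-small (≤-lit 2 6) (≤-lit 7 7)) adj)
  F₂-neighbours-H 5 j<n adj = ⊥-elim (nonadjacent-H facet-F₂ j<n (here refl) 8+e∈H₆ 6≢8+e
    (F₂-outside-small (≤-lit 2 6) (≤-lit 7 7)) 8+e∉F₂ adj)
  F₂-neighbours-H 6 j<n adj = refl
  F₂-neighbours-H 7 j<n adj = ⊥-elim (nonadjacent-H facet-F₂ j<n (∈-interval⁺ (≤+e 8 8) (+e-≤ 9 11)) (∈-interval⁺ (≤+e 8 10) ≤-refl)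
    (L-injective-13 (+e-≤ 9 10) (≤-trans (+e-≤ 10 21) (≤-reflexive (sym (+-comm (8 + e) 13)))))
    8+e∉F₂ (F₂-outside-from ≤-refl (+e-≤ 10 14)) adj)
  F₂-neighbours-H (suc (suc (suc (suc (suc (suc (suc (suc r)))))))) j<n adj with 8 + r ≤? 11 | 8 + r ≤? 12 + e
  ... | yes j≤11 | _        = ⊥-elim (nonadjacent-H-middle facet-F₂ F₂-outside-from (+-monoʳ-≤ 9 (m≤n+m (suc e) r)) j≤11 adj)
  ... | no  j≰11 | yes j≤   = ⊥-elim (nonadjacent-H-high facet-F₂ F₂-outside-from (+e-≤ 10 13) (≰⇒> j≰11) j≤ adj)
  ... | no  _    | no  j≰   = ⊥-elim (nonadjacent-H-last facet-F₂ F₂-outside-from (+e-≤ 10 14)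
                                (F₂-outside-small ≤-refl (≤-lit 3 7))
                                (subst (AdjacentFacets (n + 1)) (≤-antisym (≤-pred j<n) (≰⇒> j≰)) adj))

  F₂-neighbours-F : ∀ c → c < 4 → AdjacentFacets (n + 1) (n + c) → c ≡ 0
  F₂-neighbours-F 0 _ adj = refl
  F₂-neighbours-F 1 _ adj = ⊥-elim (¬AdjacentFacets-self facet-F₂ ∣F₂∣ adj)
  F₂-neighbours-F 2 _ adj = ⊥-elim (nonadjacent-F facet-F₂ ∣F₂∣ facet-F₃ (here refl) (there (here refl))
    (L-injective-13 (≤-lit 2 7) (≤-lit 7 14))
    (outside-F₃ (≤-lit 1 1) (≤+e 1 14) (λ ()) (λ ()) (inj₁ (≤-lit 2 10)))
    (outside-F₃ (≤-lit 1 7) (≤+e 7 14) (λ ()) (λ ()) (inj₁ (≤-lit 8 10))) adj)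
  F₂-neighbours-F 3 _ adj = ⊥-elim (nonadjacent-F facet-F₂ ∣F₂∣ facet-F₄ (here refl) (there (here refl))
    (L-injective-13 (≤-lit 2 7) (≤-lit 7 14))
    (outside-F₄ (≤-lit 1 1) (≤+e 1 14) (λ ()) (inj₁ (≤-lit 2 10)) (λ ()))
    (outside-F₄ (≤-lit 1 7) (≤+e 7 14) (λ ()) (inj₁ (≤-lit 8 10)) (λ ())) adj)
  F₂-neighbours-F (suc (suc (suc (suc c)))) (s≤s (s≤s (s≤s (s≤s ())))) adj

  H-or-F : ∀ {j} → j < n + 4 → j < n ⊎ Σ ℕ λ c → c < 4 × j ≡ n + c
  H-or-F {j} j<n+4 with j <? n
  ... | yes j<n = inj₁ j<n
  ... | no  j≮n = inj₂ (j ∸ n , +-cancelˡ-< n _ 4 (subst (_< n + 4) (sym n+c≡j) j<n+4) , sym n+c≡j)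
    where
    n+c≡j : n + (j ∸ n) ≡ j
    n+c≡j = m+[n∸m]≡n (≮⇒≥ j≮n)

  H₆-neighbours : ∀ {j} → j < n + 4 → AdjacentFacets 5 j → j ≡ 4 ⊎ j ≡ 6
  H₆-neighbours {j} j<n+4 adj with H-or-F j<n+4
  ... | inj₁ j<n                = H₆-neighbours-H j j<n adj
  ... | inj₂ (c , c<4 , refl)   = ⊥-elim (H₆-nonadjacent-F c<4 adj)

  F₁-neighbours : ∀ {j} → j < n + 4 → AdjacentFacets (n + 0) j → j ≡ 4 ⊎ j ≡ n + 1
  F₁-neighbours {j} j<n+4 adj with H-or-F j<n+4
  ... | inj₁ j<n                = inj₁ (F₁-neighbours-H j j<n adj)
  ... | inj₂ (c , c<4 , refl)   = inj₂ (cong (n +_) (F₁-neighbours-F c c<4 adj))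

  F₂-neighbours : ∀ {j} → j < n + 4 → AdjacentFacets (n + 1) j → j ≡ n + 0 ⊎ j ≡ 6
  F₂-neighbours {j} j<n+4 adj with H-or-F j<n+4
  ... | inj₁ j<n                = inj₂ (F₂-neighbours-H j j<n adj)
  ... | inj₂ (c , c<4 , refl)   = inj₁ (cong (n +_) (F₂-neighbours-F c c<4 adj))

module PathOrder (e : ℕ) where

  open import Data.Nat using (suc; _+_; _∸_; _<_; z≤n; s≤s; _≤?_; _<?_; _≟_)
  open import Data.Nat.Properties
  open import Data.List using (List; []; _∷_; _++_)
  open import Data.List.Properties using (length-++)
  open import Data.List.Membership.Propositional using (_∈_)
  open import Data.List.Membership.Propositional.Properties using (∈-++⁻; ∈-++⁺ˡ; ∈-++⁺ʳ)
  open import Data.List.Relation.Unary.Any using (here; there)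
  open import Data.List.Relation.Unary.All as All using (All; []; _∷_)
  open import Data.List.Relation.Unary.AllPairs as AllPairs using ([]; _∷_)
  open import Data.List.Relation.Unary.Unique.Propositional using (Unique)
  open import Data.List.Relation.Unary.Unique.Propositional.Properties using (++⁺)
  open import Data.List.Relation.Unary.Linked using (Linked; [-]; _∷_)
  open import Data.Product using (∃₂; _×_; _,_; proj₂)
  open import Data.Sum using (_⊎_; inj₁; inj₂)
  open import Relation.Nullary using (¬_; yes; no)
  open import Relation.Binary.PropositionalEquality
  open import Function using (_∘_)
  open ListIndexing
  open Intervals
  open Neighbourhoods e public

  private
    tail : List ℕ
    tail = interval 9 (5 + e) ++ interval 0 7 ++ n + 1 ∷ n + 0 ∷ []

    TailClass : ℕ → Set
    TailClass v = (9 ≤ v × v < 14 + e) ⊎ v < 7 ⊎ v ≡ n + 1 ⊎ v ≡ n + 0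

    ∈tail⁻ : ∀ {v} → v ∈ tail → TailClass v
    ∈tail⁻ v∈ with ∈-++⁻ (interval 9 (5 + e)) v∈
    ... | inj₁ v∈9… = inj₁ (∈-interval⁻ v∈9…)
    ... | inj₂ v∈′ with ∈-++⁻ (interval 0 7) v∈′
    ...   | inj₁ v∈0…               = inj₂ (inj₁ (proj₂ (∈-interval⁻ v∈0…)))
    ...   | inj₂ (here refl)         = inj₂ (inj₂ (inj₁ refl))
    ...   | inj₂ (there (here refl)) = inj₂ (inj₂ (inj₂ refl))

    avoids-tail : ∀ {x} → x < 9 ⊎ 14 + e ≤ x → 7 ≤ x → x ≢ n + 1 → x ≢ n + 0 → All (x ≢_) tail
    avoids-tail {x} x∉9… 7≤x x≢n+1 x≢n = All.tabulate (λ v∈ → avoid (∈tail⁻ v∈) x∉9…)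
      where
      avoid : ∀ {v} → TailClass v → x < 9 ⊎ 14 + e ≤ x → x ≢ v
      avoid (inj₁ (9≤v , _)) (inj₁ x<9)     = <⇒≢ (<-≤-trans x<9 9≤v)
      avoid (inj₁ (_ , v<))  (inj₂ 14+e≤x)  = >⇒≢ (<-≤-trans v< 14+e≤x)
      avoid (inj₂ (inj₁ v<7)) _              = >⇒≢ (<-≤-trans v<7 7≤x)
      avoid (inj₂ (inj₂ (inj₁ refl))) _      = x≢n+1
      avoid (inj₂ (inj₂ (inj₂ refl))) _      = x≢n

    n+-≢ : ∀ {c c′} → c ≢ c′ → n + c ≢ n + c′
    n+-≢ c≢c′ = c≢c′ ∘ +-cancelˡ-≡ n _ _

    unique-tail : Unique tail
    unique-tail = ++⁺ (AllPairs.map <⇒≢ (interval-sorted 9 (5 + e)))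
                      (++⁺ (AllPairs.map <⇒≢ (interval-sorted 0 7)) ((n+-≢ (λ ()) ∷ []) ∷ [] ∷ []) low-vs-F)
                      high-vs-rest
      where
      low-vs-F : ∀ {v} → ¬ (v ∈ interval 0 7 × v ∈ n + 1 ∷ n + 0 ∷ [])
      low-vs-F (v∈ , here refl)         = <⇒≱ (proj₂ (∈-interval⁻ v∈)) (≤-trans (≤+e 7 14) (m≤m+n n 1))
      low-vs-F (v∈ , there (here refl)) = <⇒≱ (proj₂ (∈-interval⁻ v∈)) (≤-trans (≤+e 7 14) (m≤m+n n 0))
      high-vs-rest : ∀ {v} → ¬ (v ∈ interval 9 (5 + e) × v ∈ interval 0 7 ++ n + 1 ∷ n + 0 ∷ [])
      high-vs-rest (v∈ , v∈′) with ∈-interval⁻ v∈ | ∈-++⁻ (interval 0 7) v∈′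
      ... | 9≤v , _  | inj₁ v∈0…               = <⇒≱ (<-≤-trans (proj₂ (∈-interval⁻ v∈0…)) (≤-lit 7 9)) 9≤v
      ... | _   , v< | inj₂ (here refl)         = <⇒≱ v< (m≤m+n n 1)
      ... | _   , v< | inj₂ (there (here refl)) = <⇒≱ v< (m≤m+n n 0)

    nth-tail : ∀ j → nth tail (j + (5 + e)) 0 ≡ nth (interval 0 7 ++ n + 1 ∷ n + 0 ∷ []) j 0
    nth-tail j = trans (cong (λ k → nth tail k 0) (trans (+-comm j (5 + e)) (cong (_+ j) (sym (length-interval 9 (5 + e))))))
                       (nth-++ʳ (interval 9 (5 + e)) _ j 0)

    <n+4 : ∀ {b} → b < 18 + e → b < n + 4
    <n+4 {b} = subst (b <_) (+-comm 4 n)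

    in-tail : ∀ {v} → v ∈ tail → v ∈ 8 ∷ 7 ∷ n + 2 ∷ n + 3 ∷ tail
    in-tail = there ∘ there ∘ there ∘ there

  -- the facets H₉ H₈ F₃ F₄ H₁₀ … Hₙ H₁ … H₇ F₂ F₁, by their indices in facetsC
  pathOrder : List ℕ
  pathOrder = 8 ∷ 7 ∷ n + 2 ∷ n + 3 ∷ tail

  length-pathOrder : length pathOrder ≡ n + 4
  length-pathOrder = begin
    4 + length tail                          ≡⟨ cong (4 +_) (length-++ (interval 9 (5 + e))) ⟩
    4 + (length (interval 9 (5 + e)) + 9)    ≡⟨ cong (λ k → 4 + (k + 9)) (length-interval 9 (5 + e)) ⟩
    4 + (5 + e + 9)                          ≡⟨ cong (4 +_) (+-comm (5 + e) 9) ⟩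
    4 + n                                    ≡⟨ +-comm 4 n ⟩
    n + 4                                    ∎
    where open ≡-Reasoning

  unique-pathOrder : Unique pathOrder
  unique-pathOrder =
      ((λ ()) ∷ (λ ()) ∷ (λ ()) ∷ avoids-tail (inj₁ ≤-refl) (≤-lit 7 8) (λ ()) (λ ()))
    ∷ ((λ ()) ∷ (λ ()) ∷ avoids-tail (inj₁ (≤-lit 8 9)) ≤-refl (λ ()) (λ ()))
    ∷ (n+-≢ (λ ()) ∷ avoids-tail (inj₂ (m≤m+n n 2)) (≤-trans (≤+e 7 14) (m≤m+n n 2)) (n+-≢ (λ ())) (n+-≢ (λ ())))
    ∷ avoids-tail (inj₂ (m≤m+n n 3)) (≤-trans (≤+e 7 14) (m≤m+n n 3)) (n+-≢ (λ ())) (n+-≢ (λ ()))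
    ∷ unique-tail

  pathOrder-bounded : All (_< n + 4) pathOrder
  pathOrder-bounded = ≤-trans (≤+e 9 14) (m≤m+n n 4) ∷ ≤-trans (≤+e 8 14) (m≤m+n n 4) ∷ +-monoʳ-< n (≤-lit 3 4) ∷ +-monoʳ-< n (≤-lit 4 4) ∷ All.tabulate (bound ∘ ∈tail⁻)
    where
    bound : ∀ {v} → TailClass v → v < n + 4
    bound (inj₁ (_ , v<))           = ≤-trans v< (m≤m+n n 4)
    bound (inj₂ (inj₁ v<7))         = ≤-trans v<7 (≤-trans (≤+e 7 14) (m≤m+n n 4))
    bound (inj₂ (inj₂ (inj₁ refl))) = +-monoʳ-< n (≤-lit 2 4)
    bound (inj₂ (inj₂ (inj₂ refl))) = +-monoʳ-< n (≤-lit 1 4)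

  pathOrder-complete : ∀ {j} → j < n + 4 → j ∈ pathOrder
  pathOrder-complete {j} j<n+4 with j <? 7 | j ≟ 7 | j ≟ 8 | j <? n
  ... | yes j<7 | _        | _        | _       = in-tail (∈-++⁺ʳ (interval 9 (5 + e)) (∈-++⁺ˡ (∈-interval⁺ z≤n j<7)))
  ... | no _    | yes refl | _        | _       = there (here refl)
  ... | no _    | no _     | yes refl | _       = here refl
  ... | no j≮7  | no j≢7   | no j≢8   | yes j<n = in-tail (∈-++⁺ˡ (∈-interval⁺ 9≤j j<n))
    where 9≤j = ≤∧≢⇒< (≤∧≢⇒< (≮⇒≥ j≮7) (≢-sym j≢7)) (≢-sym j≢8)
  ... | no _    | no _     | no _     | no j≮n  =
    subst (_∈ pathOrder) (m+[n∸m]≡n (≮⇒≥ j≮n)) (F-index (j ∸ n) (+-cancelˡ-< n _ 4 (subst (_< n + 4) (sym (m+[n∸m]≡n (≮⇒≥ j≮n))) j<n+4)))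
    where
    F-index : ∀ c → c < 4 → n + c ∈ pathOrder
    F-index 0 _ = in-tail (∈-++⁺ʳ (interval 9 (5 + e)) (∈-++⁺ʳ (interval 0 7) (there (here refl))))
    F-index 1 _ = in-tail (∈-++⁺ʳ (interval 9 (5 + e)) (∈-++⁺ʳ (interval 0 7) (here refl)))
    F-index 2 _ = there (there (here refl))
    F-index 3 _ = there (there (there (here refl)))
    F-index (suc (suc (suc (suc c)))) (s≤s (s≤s (s≤s (s≤s ()))))

  pathOrder-linked : Linked AdjacentFacets pathOrder
  pathOrder-linked =
      AdjacentFacets-sym {7} {8} (H-adjacent-next (≤+e 9 14))
    ∷ AdjacentFacets-sym {n + 2} {7} F₃-adjacent-H₈
    ∷ F₃-adjacent-F₄
    ∷ F₄-adjacent-H₁₀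
    ∷ Linked-interval-++ (λ _ k< → H-adjacent-next (s≤s k<)) H-adjacent-wrap
        (Linked-interval-++ (λ _ k< → H-adjacent-next (≤-trans (s≤s k<) (≤+e 7 14)))
          (AdjacentFacets-sym {n + 1} {6} F₂-adjacent-H₇)
          (AdjacentFacets-sym {n + 0} {n + 1} F₁-adjacent-F₂ ∷ [-]))

  PathBypass : ℕ → Set
  PathBypass q = ∃₂ λ a b → a < q × q < b × b < n + 4 × AdjacentFacets (nth pathOrder a 0) (nth pathOrder b 0)

  pathOrder-bypass : ∀ q → 0 < q → suc q < n + 4 → PathBypass q
  pathOrder-bypass q 0<q q+1< with q ≤? 3 | q ≤? 14 + e
  ... | yes q≤3 | _       = 0 , 4 , 0<q , s≤s q≤3 , <n+4 (≤+e 5 18) , H-adjacent-next (≤+e 10 14)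
  ... | no q≰3  | yes q≤  = 1 , 15 + e , ≤-trans (≤-lit 2 4) (≰⇒> q≰3) , s≤s q≤ , <n+4 (+e-≤ 16 18) ,
                            subst (AdjacentFacets 7) (sym (nth-tail 6)) (AdjacentFacets-sym {6} {7} (H-adjacent-next (≤+e 8 14)))
  ... | no _    | no q≰   = 13 + e , 17 + e , <⇒≤ (≰⇒> q≰) , ≤-pred (subst (suc q <_) (+-comm n 4) q+1<) , <n+4 ≤-refl ,
                            subst₂ AdjacentFacets (sym (nth-tail 4)) (sym (nth-tail 8)) (AdjacentFacets-sym {n + 0} {4} F₁-adjacent-H₅)

module DualGraphOfC (e : ℕ) where

  open import Data.Nat using (suc; _+_; _<_; _%_)
  open import Data.Nat.Properties
  open import Data.Nat.DivMod using (_mod_; [m+n]%n≡m%n)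
  open import Data.Fin using (toℕ; fromℕ<)
  import Data.Fin.Properties as Fin
  open import Data.Fin.Subset using (_∩_; ∣_∣)
  open import Data.Fin.Subset.Properties using (∩-comm)
  open import Data.List using (map; upTo; lookup)
  open import Data.List.Properties using (map-cong; map-∘)
  open import Data.List.Membership.Propositional using (_∈_)
  open import Data.List.Membership.Propositional.Properties using (∈-map⁺; ∈-++⁺ˡ; ∈-upTo⁺)
  import Data.List.Relation.Unary.All as All
  open import Data.Product using (_,_)
  open import Data.Sum using (_⊎_)
  import Data.Sum as Sum
  open import Relation.Nullary using (¬_)
  open import Relation.Binary.PropositionalEquality
  open import Function using (id; _∘_)
  open ListIndexing
  open PathOrder e

  m : ℕ
  m = length (facetsC d)

  E : Fin m → Fin m → Set
  E = dualC d

  E⇒AdjacentFacets : ∀ {a b} → E a b → AdjacentFacets (toℕ a) (toℕ b)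
  E⇒AdjacentFacets {a} {b} = subst₂ (λ A B → ∣ A ∩ B ∣ ≡ d) (lookup≡facet a) (lookup≡facet b)

  AdjacentFacets⇒E : ∀ {a b} → AdjacentFacets (toℕ a) (toℕ b) → E a b
  AdjacentFacets⇒E {a} {b} = subst₂ (λ A B → ∣ A ∩ B ∣ ≡ d) (sym (lookup≡facet a)) (sym (lookup≡facet b))

  E-sym : ∀ {a b} → E a b → E b a
  E-sym {a} {b} = trans (cong ∣_∣ (∩-comm (lookup (facetsC d) b) (lookup (facetsC d) a)))

  open Graphs E (λ {a} {b} → E-sym {a} {b})

  vertex : ∀ j → j < n + 4 → Fin m
  vertex j j< = fromℕ< (subst (j <_) (sym length-facetsC) j<)

  toℕ-vertex : ∀ {j} j< → toℕ (vertex j j<) ≡ j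
  toℕ-vertex j< = Fin.toℕ-fromℕ< _

  open ListPermutation {m} pathOrder (trans length-pathOrder (sym length-facetsC)) unique-pathOrder
    (All.map (λ {v} → subst (v <_) (sym length-facetsC)) pathOrder-bounded)
    (λ {j} j<m → pathOrder-complete (subst (j <_) length-facetsC j<m))

  E-permutation : ∀ {i j} → AdjacentFacets (nth pathOrder (toℕ i) 0) (nth pathOrder (toℕ j) 0) → E (permutation i) (permutation j)
  E-permutation {i} {j} = AdjacentFacets⇒E ∘ subst₂ AdjacentFacets (sym (toℕ-permutation i)) (sym (toℕ-permutation j))

  path-adjacent : ∀ i j → toℕ j ≡ suc (toℕ i) → E (permutation i) (permutation j)
  path-adjacent i j toℕj≡ = E-permutation {i} {j}
    (subst (λ k → AdjacentFacets _ (nth pathOrder k 0)) (sym toℕj≡)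
      (nth-Linked 0 pathOrder-linked (subst₂ _<_ toℕj≡ (trans length-facetsC (sym length-pathOrder)) (Fin.toℕ<n j))))

  hamiltonianPath : HamiltonianPath m E
  hamiltonianPath = permutation , (permutation-injective , permutation-surjective) , path-adjacent

  twoConnected : TwoConnected m E
  twoConnected = bypasses⇒twoConnected (subst (3 ≤_) (sym length-facetsC) (≤-trans (≤+e 3 14) (m≤m+n n 4))) bypass
    where
    open HamiltonianPathWalks permutation permutation-injective permutation-surjective path-adjacent
    bypass : ∀ q → 0 < toℕ q → suc (toℕ q) < m → Bypass q
    bypass q 0<q q+1<m = lift (pathOrder-bypass (toℕ q) 0<q (subst (suc (toℕ q) <_) length-facetsC q+1<m))
      where
      lift : PathBypass (toℕ q) → Bypass q
      lift (a , b , a<q , q<b , b< , adj) = vertex a a< , vertex b b< ,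
          subst (_< toℕ q) (sym (toℕ-vertex a<)) a<q , subst (toℕ q <_) (sym (toℕ-vertex b<)) q<b ,
          E-permutation {vertex a a<} {vertex b b<}
            (subst₂ (λ i j → AdjacentFacets (nth pathOrder i 0) (nth pathOrder j 0)) (sym (toℕ-vertex a<)) (sym (toℕ-vertex b<)) adj)
        where
        a< : a < n + 4
        a< = <-trans a<q (<-trans q<b b<)

  vertex-≢ : ∀ {i j i< j<} → i ≢ j → vertex i i< ≢ vertex j j<
  vertex-≢ {i< = i<} {j<} i≢j eq = i≢j (trans (sym (toℕ-vertex i<)) (trans (cong toℕ eq) (toℕ-vertex j<)))

  neighbours : ∀ {i a b} (i< : i < n + 4) (a< : a < n + 4) (b< : b < n + 4) →
               (∀ {j} → j < n + 4 → AdjacentFacets i j → j ≡ a ⊎ j ≡ b) →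
               NeighboursIn (vertex i i<) (vertex a a<) (vertex b b<)
  neighbours i< a< b< classify x Ex =
    Sum.map (toℕ-injective-vertex a<) (toℕ-injective-vertex b<)
      (classify (subst (toℕ x <_) length-facetsC (Fin.toℕ<n x))
                (subst (λ k → AdjacentFacets k (toℕ x)) (toℕ-vertex i<) (E⇒AdjacentFacets Ex)))
    where
    toℕ-injective-vertex : ∀ {k} (k< : k < n + 4) → toℕ x ≡ k → x ≡ vertex k k<
    toℕ-injective-vertex k< toℕx≡k = Fin.toℕ-injective (trans toℕx≡k (sym (toℕ-vertex k<)))

  ¬hamiltonianCycle : ¬ HamiltonianCycle m E
  ¬hamiltonianCycle = ¬HamiltonianCycle-pentagon (subst (6 ≤_) (sym length-facetsC) (≤-trans (≤+e 6 14) (m≤m+n n 4)))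
    (vertex-≢ {i< = F₁<} {H₆<} (λ ())) (vertex-≢ {i< = F₁<} {H₇<} (λ ()))
    (vertex-≢ {i< = F₂<} {H₆<} (λ ())) (vertex-≢ {i< = F₂<} {H₅<} (λ ()))
    (neighbours H₆< H₅< H₇< H₆-neighbours) (neighbours F₁< H₅< F₂< F₁-neighbours) (neighbours F₂< F₁< H₇< F₂-neighbours)
    where
    H₅< : 4 < n + 4
    H₅< = ≤-trans (≤+e 5 14) (m≤m+n n 4)
    H₆< : 5 < n + 4
    H₆< = ≤-trans (≤+e 6 14) (m≤m+n n 4)
    H₇< : 6 < n + 4
    H₇< = ≤-trans (≤+e 7 14) (m≤m+n n 4)
    F₁< : n + 0 < n + 4
    F₁< = +-monoʳ-< n (≤-lit 1 4)
    F₂< : n + 1 < n + 4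
    F₂< = +-monoʳ-< n (≤-lit 2 4)

  tightHamiltonian : TightHamiltonian n d (facetsC d)
  tightHamiltonian = id , ((λ eq → eq) , (λ y → y , λ eq → eq)) , λ i →
    subst (_∈ facetsC d) (sym (window≡H (toℕ i))) (∈-++⁺ˡ (∈-map⁺ (λ k → H d (suc k)) (∈-upTo⁺ (Fin.toℕ<n i))))
    where
    shift : ∀ k t → (k + t) mod n ≡ lab d (suc k + t)
    shift k t = Fin.toℕ-injective (begin
      toℕ ((k + t) mod n)         ≡⟨ Fin.toℕ-fromℕ< _ ⟩
      (k + t) % n                 ≡⟨ sym ([m+n]%n≡m%n (k + t) n) ⟩
      (k + t + n) % n             ≡⟨ cong (_% n) (+-suc (k + t) (13 + e)) ⟩
      (suc k + t + (13 + e)) % n  ≡⟨ sym (Fin.toℕ-fromℕ< _) ⟩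
      toℕ (lab d (suc k + t))     ∎)
      where open ≡-Reasoning
    window≡H : ∀ k → setOf (map (λ t → (k + t) mod n) (upTo (suc d))) ≡ H d (suc k)
    window≡H k = cong setOf (trans (map-cong (shift k) (upTo (suc d))) (map-∘ (upTo (suc d))))

mainTheorem4 : (d : ℕ) → 2 ≤ d →
    TightHamiltonian (nC d) d (facetsC d) ×
    TwoConnected (length (facetsC d)) (dualC d) ×
    ¬ HamiltonianCycle (length (facetsC d)) (dualC d) ×
    HamiltonianPath (length (facetsC d)) (dualC d)
mainTheorem4 (suc (suc e)) _ = tightHamiltonian , twoConnected , ¬hamiltonianCycle , hamiltonianPath
  where open DualGraphOfC e
mainTheorem4 (suc zero) (s≤s ())
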